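{- Let $P$ be a graded poset of rank $d+1$. Then $P$ is $1$-Sing if and only if its reduced order complex $O(P)$ satisfies: for every face $F\in O(P)$ with $\dim F\geq1$, $\tilde\chi(\mathrm{lk}_{O(P)}F)=(-1)^{d-1-|F|}$.
   Context: Posets are finite and graded with unique $\hat0$, $\hat1$, rank function $\rho$, and Möbius function $\mu_P$; the length of an interval $[s,t]$ is $\rho(t)-\rho(s)$. A graded poset $Q$ is Eulerian if $\mu_Q(s,t)=(-1)^{\rho(t)-\rho(s)}$ for all $s\le t$ in $Q$; an interval $[s,t]$ of $P$ is Eulerian if it is Eulerian as a poset. $P$ of rank $d+1$ is $1$-Sing if every interval $[s,t]$ of $P$ of length $\le d-1$ is Eulerian. The reduced order complex $O(P)$ is the simplicial complex on vertex set $P\setminus\{\hat0,\hat1\}$ whose faces are the chains of $P\setminus\{\hat0,\hat1\}$. For a simplicial complex, $\mathrm{lk}F=\{G:F\cup G\text{ a face},\ F\cap G=\emptyset\}$ and $\tilde\chi(\Gamma)=\sum_{i\ge-1}(-1)^if_i(\Gamma)$, $f_i$ being the number of $i$-dimensional faces. -}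

module Defs where

open import Data.Nat as ℕ using (ℕ; zero; suc; _∸_)
open import Data.Integer as ℤ using (ℤ; +_; -_)
open import Data.Fin using (Fin)
open import Data.Fin.Properties using (all?; _≟_)
open import Data.Fin.Subset using (Subset; _∈_; _∉_; _∪_; ∣_∣; inside; outside)
open import Data.Fin.Subset.Properties using (_∈?_)
open import Data.List using (List; []; _∷_; map; _++_; filter; sum; allFin)
open import Data.Vec using (_∷_; [])
open import Data.Product using (_×_; _,_)
open import Data.Sum using (_⊎_)
open import Relation.Nullary using (¬_; Dec; yes; no)
open import Relation.Nullary.Decidable using (_×-dec_; _⊎-dec_; ¬?; _→-dec_)
open import Relation.Binary using (IsPartialOrder; Decidable)
open import Relation.Binary.PropositionalEquality using (_≡_; _≢_)

negOnePow : ℕ → ℤ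
negOnePow zero = + 1
negOnePow (suc k) = - negOnePow k

negOnePowℤ : ℤ → ℤ
negOnePowℤ z = negOnePow ℤ.∣ z ∣

sumℤ : List ℤ → ℤ
sumℤ [] = + 0
sumℤ (x ∷ xs) = x ℤ.+ sumℤ xs

record GradedPoset (r : ℕ) : Set₁ where
  field
    size           : ℕ
    _≼_            : Fin size → Fin size → Set
    isPartialOrder : IsPartialOrder _≡_ _≼_
    _≼?_           : Decidable _≼_
    bot top        : Fin size
    bot-min        : ∀ x → bot ≼ x
    top-max        : ∀ x → x ≼ top
    ρ              : Fin size → ℕ
    ρ-bot          : ρ bot ≡ 0
    ρ-top          : ρ top ≡ r
    ρ-cover        : ∀ x y → x ≼ y → x ≢ y →
                     (∀ z → x ≼ z → z ≼ y → z ≡ x ⊎ z ≡ y) →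
                     ρ y ≡ suc (ρ x)

module _ {r : ℕ} (P : GradedPoset r) where
  open GradedPoset P

  -- The recursion is run with fuel; fuel `size` suffices since every
  -- chain in P has fewer than `size` steps.

  mobF : ℕ → Fin size → Fin size → ℤ
  mobF zero s t with s ≟ t
  ... | yes _ = + 1
  ... | no _  = + 0
  mobF (suc k) s t with s ≟ t
  ... | yes _ = + 1
  ... | no _ with s ≼? t
  ...   | no _  = + 0
  ...   | yes _ = - sumℤ (map (mobF k s)
                    (filter (λ u → (s ≼? u) ×-dec ((u ≼? t) ×-dec ¬? (u ≟ t)))
                            (allFin size)))

  μ : Fin size → Fin size → ℤ
  μ = mobF size

  -- The interval [s,t] is Eulerian (as a poset, whose Möbius function is
  -- the restriction of μ and whose rank function is ρ - ρ s).
  EulerianInterval : Fin size → Fin size → Set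
  EulerianInterval s t =
    ∀ u v → s ≼ u → u ≼ v → v ≼ t →
      μ u v ≡ negOnePow (ρ v ∸ ρ u)

  -- P (of rank d+1) is 1-Sing: every interval of length ≤ d - 1 is Eulerian.
  OneSing : (d : ℕ) → Set
  OneSing d = ∀ s t → s ≼ t → suc (ρ t ∸ ρ s) ℕ.≤ d → EulerianInterval s t

  -- Reduced order complex O(P): vertex set P ∖ {0̂,1̂}, faces = chains
  -- (including the empty face).

  IsFace : Subset size → Set
  IsFace F = (∀ x → x ∈ F → (x ≢ bot × x ≢ top)) ×
             (∀ x y → x ∈ F → y ∈ F → (x ≼ y ⊎ y ≼ x))

  isFace? : (F : Subset size) → Dec (IsFace F)
  isFace? F =
    all? (λ x → (x ∈? F) →-dec (¬? (x ≟ bot) ×-dec ¬? (x ≟ top)))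
    ×-dec
    all? (λ x → all? (λ y → (x ∈? F) →-dec ((y ∈? F) →-dec ((x ≼? y) ⊎-dec (y ≼? x)))))

  Disjoint : Subset size → Subset size → Set
  Disjoint F G = ∀ x → x ∈ F → x ∉ G

  disjoint? : (F G : Subset size) → Dec (Disjoint F G)
  disjoint? F G = all? (λ x → (x ∈? F) →-dec ¬? (x ∈? G))

  InLink : Subset size → Subset size → Set
  InLink F G = IsFace (F ∪ G) × Disjoint F G

  inLink? : (F G : Subset size) → Dec (InLink F G)
  inLink? F G = isFace? (F ∪ G) ×-dec disjoint? F G

allSubsets : (n : ℕ) → List (Subset n)
allSubsets zero = [] ∷ []
allSubsets (suc n) = map (inside ∷_) (allSubsets n) ++ map (outside ∷_) (allSubsets n)

dimℤ : {n : ℕ} → Subset n → ℤ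
dimℤ G = + ∣ G ∣ ℤ.- + 1

-- reduced Euler characteristic of a (decidable) simplicial complex Γ
-- on vertex set Fin n:  χ̃(Γ) = Σ_{i ≥ -1} (-1)^i f_i(Γ) = Σ_{G ∈ Γ} (-1)^{dim G}
χ̃ : {n : ℕ} {Γ : Subset n → Set} → ((G : Subset n) → Dec (Γ G)) → ℤ
χ̃ {n} Γ? = sumℤ (map (λ G → negOnePowℤ (dimℤ G)) (filter Γ? (allSubsets n)))

-- By Philip Hall's theorem μ(s,t) is the reduced Euler characteristic of the order complex of the
-- open interval (s,t). A face G of lk F corresponds to the chain C = F ∪ G ⊇ F, so χ̃(lk F) is
-- (-1)^|F| times a signed count of the chains of (0̂,1̂) through F; cutting these chains at the
-- elements of F factors that count as the product of μ(a,b) over consecutive elements a < b of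
-- F ∪ {0̂,1̂}. If P is 1-Sing and |F| ≥ 2, each such [a,b] has length at most d - 1, contributes
-- (-1)^(ρ b - ρ a), and the product is (-1)^(d+1). Conversely, an interval [u,v] of length at most
-- d - 1 lies in a face G all of whose other segments are covers (μ = -1); G has at least two
-- elements, so the link condition for G determines μ(u,v) = (-1)^(ρ v - ρ u).

module Submission where

open import Defs
open import Data.Bool using (if_then_else_)
open import Data.Empty using (⊥-elim)
open import Data.Fin using (Fin; zero; suc)
import Data.Fin.Properties as FinP
open import Data.Fin.Subset using (Subset; _∈_; _∉_; ∣_∣; inside; outside; _∪_; _⊆_; ⁅_⁆; ∁)
  renaming (⊥ to ∅; _-_ to _∖_)
open import Data.Fin.Subset.Properties
  using (_∈?_; _⊆?_; ∉⊥; nonempty?; Empty-unique; ∣⊥∣≡0; x∉p⇒x∈∁p; x∈∁p⇒x∉p;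
         x∈⁅y⁆⇒x≡y; ∣⁅x⁆∣≡1; x∈p⇒∣p-x∣<∣p∣; x∈p∧x≢y⇒x∈p-y; p⊆q⇒∣p∣≤∣q∣)
open import Data.Integer as ℤ using (ℤ; +_; -_; _+_; _*_; _-_)
import Data.Integer.Properties as ℤP
open import Algebra.Properties.Semiring.Sum ℤP.+-*-semiring
  using (sum; sum-cong-≗; sum-replicate-zero; ∑-distrib-+; *-distribˡ-sum)
open import Data.Integer.Tactic.RingSolver using (solve-∀)
open import Data.List using (List; map; filter; allFin; tabulate; _++_)
import Data.List.Properties as ListP
open import Data.Nat as ℕ using (ℕ; zero; suc; _∸_; _≤_; _<_; z≤n; s≤s)
import Data.Nat.Properties as ℕP
open import Data.Product using (Σ; _×_; _,_; proj₁; proj₂)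
open import Data.Sum using (_⊎_; inj₁; inj₂; [_,_]′)
open import Data.Vec using (_∷_; []; here; there; _[_]≔_)
import Data.Vec as Vec
open import Function using (_∘_)
open import Level using (Level)
open import Relation.Binary using (IsPartialOrder)
open import Relation.Binary.PropositionalEquality hiding (isPartialOrder)
open import Relation.Nullary using (¬_; Dec; yes; no; does)
open import Relation.Nullary.Decidable using (_×-dec_; ¬?; _→-dec_; _⊎-dec_)

-- Finite sums with Iverson brackets

infixr 8 ⟦_⟧·_

⟦_⟧·_ : ∀ {a} {A : Set a} → Dec A → ℤ → ℤ
⟦ d ⟧· x = if does d then x else + 0

module _ {a} {A : Set a} where

  ⟦⟧·-yes : (d : Dec A) {x : ℤ} → A → ⟦ d ⟧· x ≡ x
  ⟦⟧·-yes (yes _) _ = refl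
  ⟦⟧·-yes (no ¬a) a = ⊥-elim (¬a a)

  ⟦⟧·-no : (d : Dec A) {x : ℤ} → ¬ A → ⟦ d ⟧· x ≡ + 0
  ⟦⟧·-no (yes a) ¬a = ⊥-elim (¬a a)
  ⟦⟧·-no (no _) _ = refl

  ⟦⟧·-zero : (d : Dec A) → ⟦ d ⟧· + 0 ≡ + 0
  ⟦⟧·-zero (yes _) = refl
  ⟦⟧·-zero (no _) = refl

  ⟦⟧·-neg : (d : Dec A) {x : ℤ} → ⟦ d ⟧· (- x) ≡ - ⟦ d ⟧· x
  ⟦⟧·-neg (yes _) = refl
  ⟦⟧·-neg (no _) = refl

  ⟦⟧·-*ˡ : (d : Dec A) (c : ℤ) {x : ℤ} → ⟦ d ⟧· (c * x) ≡ c * ⟦ d ⟧· x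
  ⟦⟧·-*ˡ (yes _) c = refl
  ⟦⟧·-*ˡ (no _) c = sym (ℤP.*-zeroʳ c)

  ⟦⟧·-cong : ∀ {b} {B : Set b} (d : Dec A) (e : Dec B) {x y : ℤ} →
             (A → B) → (B → A) → (A → x ≡ y) → ⟦ d ⟧· x ≡ ⟦ e ⟧· y
  ⟦⟧·-cong (yes a) (yes b) f g h = h a
  ⟦⟧·-cong (yes a) (no ¬b) f g h = ⊥-elim (¬b (f a))
  ⟦⟧·-cong (no ¬a) (yes b) f g h = ⊥-elim (¬a (g b))
  ⟦⟧·-cong (no _) (no _) f g h = refl

  ⟦⟧·-× : ∀ {b} {B : Set b} (d : Dec A) (e : Dec B) {x : ℤ} → ⟦ d ×-dec e ⟧· x ≡ ⟦ d ⟧· ⟦ e ⟧· x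
  ⟦⟧·-× (yes _) (yes _) = refl
  ⟦⟧·-× (yes _) (no _) = refl
  ⟦⟧·-× (no _) e = refl

⟦⟧·-comm : ∀ {a b} {A : Set a} {B : Set b} (d : Dec A) (e : Dec B) {x : ℤ} →
           ⟦ d ⟧· ⟦ e ⟧· x ≡ ⟦ e ⟧· ⟦ d ⟧· x
⟦⟧·-comm (yes _) e = refl
⟦⟧·-comm (no _) e = sym (⟦⟧·-zero e)

⟦⟧·-cong₃₂ : ∀ {a b c d e} {A : Set a} {B : Set b} {C : Set c} {D : Set d} {E : Set e}
  (a? : Dec A) (b? : Dec B) (c? : Dec C) (d? : Dec D) (e? : Dec E) {x : ℤ} →
  (A × B × C → D × E) → (D × E → A × B × C) → ⟦ a? ⟧· ⟦ b? ⟧· ⟦ c? ⟧· x ≡ ⟦ d? ⟧· ⟦ e? ⟧· x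
⟦⟧·-cong₃₂ a? b? c? d? e? f g =
  begin
    ⟦ a? ⟧· ⟦ b? ⟧· ⟦ c? ⟧· _     ≡⟨ cong (⟦ a? ⟧·_) (sym (⟦⟧·-× b? c?)) ⟩
    ⟦ a? ⟧· ⟦ b? ×-dec c? ⟧· _    ≡⟨ sym (⟦⟧·-× a? (b? ×-dec c?)) ⟩
    ⟦ a? ×-dec b? ×-dec c? ⟧· _   ≡⟨ ⟦⟧·-cong (a? ×-dec b? ×-dec c?) (d? ×-dec e?) f g (λ _ → refl) ⟩
    ⟦ d? ×-dec e? ⟧· _            ≡⟨ ⟦⟧·-× d? e? ⟩
    ⟦ d? ⟧· ⟦ e? ⟧· _             ∎
  where open ≡-Reasoning

sum-zero : ∀ {n} {f : Fin n → ℤ} → (∀ u → f u ≡ + 0) → sum f ≡ + 0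
sum-zero {n} f≗0 = trans (sum-cong-≗ f≗0) (sum-replicate-zero n)

sum-neg : ∀ {n} (f : Fin n → ℤ) → sum (λ u → - f u) ≡ - sum f
sum-neg {zero} f = refl
sum-neg {suc n} f = trans (cong (_+_ (- f zero)) (sum-neg (f ∘ suc))) (sym (ℤP.neg-distrib-+ (f zero) _))

sum-single : ∀ {n} (f : Fin n → ℤ) a → (∀ u → u ≢ a → f u ≡ + 0) → sum f ≡ f a
sum-single {suc n} f zero h =
  trans (cong (_+_ (f zero)) (sum-zero (λ u → h (suc u) λ ()))) (ℤP.+-identityʳ _)
sum-single {suc n} f (suc a) h =
  trans (cong₂ _+_ (h zero λ ()) (sum-single (f ∘ suc) a λ u u≢a → h (suc u) (u≢a ∘ FinP.suc-injective)))
        (ℤP.+-identityˡ _)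

∑ˢ : ∀ {n} → (Subset n → ℤ) → ℤ
∑ˢ {zero} g = g []
∑ˢ {suc n} g = ∑ˢ (λ C → g (inside ∷ C)) + ∑ˢ (λ C → g (outside ∷ C))

∑ˢ-cong : ∀ {n} {f g : Subset n → ℤ} → (∀ C → f C ≡ g C) → ∑ˢ f ≡ ∑ˢ g
∑ˢ-cong {zero} h = h []
∑ˢ-cong {suc n} h = cong₂ _+_ (∑ˢ-cong (h ∘ (inside ∷_))) (∑ˢ-cong (h ∘ (outside ∷_)))

∑ˢ-zero : ∀ {n} {f : Subset n → ℤ} → (∀ C → f C ≡ + 0) → ∑ˢ f ≡ + 0
∑ˢ-zero {zero} h = h []
∑ˢ-zero {suc n} h = cong₂ _+_ (∑ˢ-zero (h ∘ (inside ∷_))) (∑ˢ-zero (h ∘ (outside ∷_)))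

∑ˢ-neg : ∀ {n} (f : Subset n → ℤ) → ∑ˢ (λ C → - f C) ≡ - ∑ˢ f
∑ˢ-neg {zero} f = refl
∑ˢ-neg {suc n} f =
  trans (cong₂ _+_ (∑ˢ-neg (f ∘ (inside ∷_))) (∑ˢ-neg (f ∘ (outside ∷_))))
        (sym (ℤP.neg-distrib-+ (∑ˢ (f ∘ (inside ∷_))) _))

∑ˢ-distrib-+ : ∀ {n} (f g : Subset n → ℤ) → ∑ˢ (λ C → f C + g C) ≡ ∑ˢ f + ∑ˢ g
∑ˢ-distrib-+ {zero} f g = refl
∑ˢ-distrib-+ {suc n} f g =
  trans (cong₂ _+_ (∑ˢ-distrib-+ (f ∘ (inside ∷_)) (g ∘ (inside ∷_)))
                   (∑ˢ-distrib-+ (f ∘ (outside ∷_)) (g ∘ (outside ∷_))))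
        (+-interchange (∑ˢ (f ∘ (inside ∷_))) (∑ˢ (g ∘ (inside ∷_))) (∑ˢ (f ∘ (outside ∷_))) (∑ˢ (g ∘ (outside ∷_))))
  where
  +-interchange : ∀ a b c e → a + b + (c + e) ≡ a + c + (b + e)
  +-interchange = solve-∀

∑ˢ-sum-comm : ∀ {n m} (g : Fin m → Subset n → ℤ) → ∑ˢ (λ C → sum (λ u → g u C)) ≡ sum (λ u → ∑ˢ (g u))
∑ˢ-sum-comm {zero} g = refl
∑ˢ-sum-comm {suc n} g =
  trans (cong₂ _+_ (∑ˢ-sum-comm (λ u → g u ∘ (inside ∷_))) (∑ˢ-sum-comm (λ u → g u ∘ (outside ∷_))))
        (sym (∑-distrib-+ (λ u → ∑ˢ (g u ∘ (inside ∷_))) (λ u → ∑ˢ (g u ∘ (outside ∷_)))))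

∑ˢ-single : ∀ {n} (f : Subset n → ℤ) A → (∀ C → C ≢ A → f C ≡ + 0) → ∑ˢ f ≡ f A
∑ˢ-single {zero} f [] h = refl
∑ˢ-single {suc n} f (inside ∷ A) h =
  trans (cong₂ _+_ (∑ˢ-single (f ∘ (inside ∷_)) A λ C C≢A → h _ (C≢A ∘ cong Vec.tail))
                   (∑ˢ-zero λ C → h (outside ∷ C) λ ()))
        (ℤP.+-identityʳ _)
∑ˢ-single {suc n} f (outside ∷ A) h =
  trans (cong₂ _+_ (∑ˢ-zero λ C → h (inside ∷ C) λ ())
                   (∑ˢ-single (f ∘ (outside ∷_)) A λ C C≢A → h _ (C≢A ∘ cong Vec.tail)))
        (ℤP.+-identityˡ _)

∑ˢ-⟦⟧· : ∀ {n a} {A : Set a} (d : Dec A) (f : Subset n → ℤ) → ∑ˢ (λ C → ⟦ d ⟧· f C) ≡ ⟦ d ⟧· ∑ˢ f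
∑ˢ-⟦⟧· (yes _) f = refl
∑ˢ-⟦⟧· {n} (no _) f = ∑ˢ-zero {n} λ _ → refl

insert : ∀ {n} → Fin n → Subset n → Subset n
insert u C = C [ u ]≔ inside

∈-insert-here : ∀ {n} u (C : Subset n) → u ∈ insert u C
∈-insert-here zero (s ∷ C) = here
∈-insert-here (suc u) (s ∷ C) = there (∈-insert-here u C)

∈-insert⁺ : ∀ {n} u (C : Subset n) {x} → x ∈ C → x ∈ insert u C
∈-insert⁺ zero (s ∷ C) here = here
∈-insert⁺ zero (s ∷ C) (there x∈C) = there x∈C
∈-insert⁺ (suc u) (s ∷ C) here = here
∈-insert⁺ (suc u) (s ∷ C) (there x∈C) = there (∈-insert⁺ u C x∈C)

∈-insert⁻ : ∀ {n} u (C : Subset n) {x} → x ∈ insert u C → x ≡ u ⊎ x ∈ C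
∈-insert⁻ zero (s ∷ C) here = inj₁ refl
∈-insert⁻ zero (s ∷ C) (there x∈) = inj₂ (there x∈)
∈-insert⁻ (suc u) (s ∷ C) here = inj₂ here
∈-insert⁻ (suc u) (s ∷ C) (there x∈) with ∈-insert⁻ u C x∈
... | inj₁ refl = inj₁ refl
... | inj₂ x∈C = inj₂ (there x∈C)

∑ˢ-insert : ∀ {n} (u : Fin n) (g : ℕ → Subset n → ℤ) →
  ∑ˢ (λ C → ⟦ u ∈? C ⟧· g ∣ C ∣ C) ≡ ∑ˢ (λ C → ⟦ ¬? (u ∈? C) ⟧· g (suc ∣ C ∣) (insert u C))
∑ˢ-insert {suc n} zero g = ℤP.+-comm (∑ˢ (λ C → g (suc ∣ C ∣) (inside ∷ C))) (∑ˢ {n} (λ _ → + 0))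
∑ˢ-insert {suc n} (suc u) g =
  cong₂ _+_ (∑ˢ-insert u (λ m C → g (suc m) (inside ∷ C))) (∑ˢ-insert u (λ m C → g m (outside ∷ C)))

∑ˢ-disjoint-∪ : ∀ {n} (F : Subset n) (k : Subset n → ℤ) →
  ∑ˢ (λ G → ⟦ F ⊆? ∁ G ⟧· (negOnePow ∣ G ∣ * k (F ∪ G))) ≡
  negOnePow ∣ F ∣ * ∑ˢ (λ C → ⟦ F ⊆? C ⟧· (negOnePow ∣ C ∣ * k C))
∑ˢ-disjoint-∪ {zero} [] k = sym (ℤP.*-identityˡ _)
∑ˢ-disjoint-∪ {suc n} (inside ∷ F) k =
  begin
    ∑ˢ {n} (λ _ → + 0) + ∑ˢ (λ G → ⟦ F ⊆? ∁ G ⟧· (negOnePow ∣ G ∣ * k (inside ∷ (F ∪ G))))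
  ≡⟨ cong₂ _+_ (∑ˢ-zero {n} λ _ → refl) (∑ˢ-disjoint-∪ F (k ∘ (inside ∷_))) ⟩
    + 0 + negOnePow ∣ F ∣ * S
  ≡⟨ rearrange (negOnePow ∣ F ∣) S ⟩
    - negOnePow ∣ F ∣ * (- S + + 0)
  ≡⟨ cong (λ z → - negOnePow ∣ F ∣ * (z + + 0)) (sym ∑-negated) ⟩
    - negOnePow ∣ F ∣ * (∑ˢ (λ C → ⟦ F ⊆? C ⟧· (- negOnePow ∣ C ∣ * k (inside ∷ C))) + + 0)
  ≡⟨ cong (λ z → - negOnePow ∣ F ∣ * (∑ˢ (λ C → ⟦ F ⊆? C ⟧· (- negOnePow ∣ C ∣ * k (inside ∷ C))) + z))
          (sym (∑ˢ-zero {n} λ _ → refl)) ⟩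
    - negOnePow ∣ F ∣ * (∑ˢ (λ C → ⟦ F ⊆? C ⟧· (- negOnePow ∣ C ∣ * k (inside ∷ C))) + ∑ˢ {n} (λ _ → + 0))
  ∎
  where
  open ≡-Reasoning
  S : ℤ
  S = ∑ˢ (λ C → ⟦ F ⊆? C ⟧· (negOnePow ∣ C ∣ * k (inside ∷ C)))
  rearrange : ∀ a S → + 0 + a * S ≡ (- a) * (- S + + 0)
  rearrange = solve-∀
  ∑-negated : ∑ˢ (λ C → ⟦ F ⊆? C ⟧· (- negOnePow ∣ C ∣ * k (inside ∷ C))) ≡ - S
  ∑-negated = trans (∑ˢ-cong λ C → trans (cong (⟦ F ⊆? C ⟧·_) (sym (ℤP.neg-distribˡ-* (negOnePow ∣ C ∣) _)))
                                          (⟦⟧·-neg (F ⊆? C)))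
                    (∑ˢ-neg (λ C → ⟦ F ⊆? C ⟧· (negOnePow ∣ C ∣ * k (inside ∷ C))))
∑ˢ-disjoint-∪ {suc n} (outside ∷ F) k =
  begin
    ∑ˢ (λ G → ⟦ F ⊆? ∁ G ⟧· (- negOnePow ∣ G ∣ * k (inside ∷ (F ∪ G))))
      + ∑ˢ (λ G → ⟦ F ⊆? ∁ G ⟧· (negOnePow ∣ G ∣ * k (outside ∷ (F ∪ G))))
  ≡⟨ cong₂ _+_ (∑ˢ-cong λ G → cong (⟦ F ⊆? ∁ G ⟧·_) (move-neg (negOnePow ∣ G ∣) (k (inside ∷ (F ∪ G)))))
               (∑ˢ-disjoint-∪ F (k ∘ (outside ∷_))) ⟩
    ∑ˢ (λ G → ⟦ F ⊆? ∁ G ⟧· (negOnePow ∣ G ∣ * - k (inside ∷ (F ∪ G))))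
      + negOnePow ∣ F ∣ * ∑ˢ (λ C → ⟦ F ⊆? C ⟧· (negOnePow ∣ C ∣ * k (outside ∷ C)))
  ≡⟨ cong (_+ negOnePow ∣ F ∣ * ∑ˢ (λ C → ⟦ F ⊆? C ⟧· (negOnePow ∣ C ∣ * k (outside ∷ C))))
          (∑ˢ-disjoint-∪ F (λ C → - k (inside ∷ C))) ⟩
    negOnePow ∣ F ∣ * ∑ˢ (λ C → ⟦ F ⊆? C ⟧· (negOnePow ∣ C ∣ * - k (inside ∷ C)))
      + negOnePow ∣ F ∣ * ∑ˢ (λ C → ⟦ F ⊆? C ⟧· (negOnePow ∣ C ∣ * k (outside ∷ C)))
  ≡⟨ sym (ℤP.*-distribˡ-+ (negOnePow ∣ F ∣) (∑ˢ (λ C → ⟦ F ⊆? C ⟧· (negOnePow ∣ C ∣ * - k (inside ∷ C))))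
                                              (∑ˢ (λ C → ⟦ F ⊆? C ⟧· (negOnePow ∣ C ∣ * k (outside ∷ C))))) ⟩
    negOnePow ∣ F ∣ * (∑ˢ (λ C → ⟦ F ⊆? C ⟧· (negOnePow ∣ C ∣ * - k (inside ∷ C)))
      + ∑ˢ (λ C → ⟦ F ⊆? C ⟧· (negOnePow ∣ C ∣ * k (outside ∷ C))))
  ≡⟨ cong (λ z → negOnePow ∣ F ∣ * (z + ∑ˢ (λ C → ⟦ F ⊆? C ⟧· (negOnePow ∣ C ∣ * k (outside ∷ C)))))
          (∑ˢ-cong λ C → cong (⟦ F ⊆? C ⟧·_) (sym (move-neg (negOnePow ∣ C ∣) (k (inside ∷ C))))) ⟩
    negOnePow ∣ F ∣ * (∑ˢ (λ C → ⟦ F ⊆? C ⟧· (- negOnePow ∣ C ∣ * k (inside ∷ C)))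
      + ∑ˢ (λ C → ⟦ F ⊆? C ⟧· (negOnePow ∣ C ∣ * k (outside ∷ C))))
  ∎
  where
  open ≡-Reasoning
  move-neg : ∀ a x → - a * x ≡ a * - x
  move-neg a x = trans (sym (ℤP.neg-distribˡ-* a x)) (ℤP.neg-distribʳ-* a x)

sumℤ-++ : ∀ xs ys → sumℤ (xs ++ ys) ≡ sumℤ xs + sumℤ ys
sumℤ-++ Data.List.[] ys = sym (ℤP.+-identityˡ _)
sumℤ-++ (x Data.List.∷ xs) ys = trans (cong (_+_ x) (sumℤ-++ xs ys)) (sym (ℤP.+-assoc x _ _))

sumℤ-map-filter : ∀ {a p} {A : Set a} {P : A → Set p} (P? : ∀ x → Dec (P x)) (f : A → ℤ) xs →
  sumℤ (map f (filter P? xs)) ≡ sumℤ (map (λ x → ⟦ P? x ⟧· f x) xs)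
sumℤ-map-filter P? f Data.List.[] = refl
sumℤ-map-filter P? f (x Data.List.∷ xs) with P? x
... | yes _ = cong (_+_ (f x)) (sumℤ-map-filter P? f xs)
... | no _ = trans (sumℤ-map-filter P? f xs) (sym (ℤP.+-identityˡ _))

sumℤ-allFin : ∀ {n} (f : Fin n → ℤ) → sumℤ (map f (allFin n)) ≡ sum f
sumℤ-allFin f = trans (cong sumℤ (ListP.map-tabulate (λ u → u) f)) (sumℤ-tabulate f)
  where
  sumℤ-tabulate : ∀ {n} (g : Fin n → ℤ) → sumℤ (tabulate g) ≡ sum g
  sumℤ-tabulate {zero} g = refl
  sumℤ-tabulate {suc n} g = cong (_+_ (g zero)) (sumℤ-tabulate (g ∘ suc))

sumℤ-allSubsets : ∀ n (f : Subset n → ℤ) → sumℤ (map f (allSubsets n)) ≡ ∑ˢ f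
sumℤ-allSubsets zero f = ℤP.+-identityʳ _
sumℤ-allSubsets (suc n) f =
  begin
    sumℤ (map f (map (inside ∷_) S ++ map (outside ∷_) S))
  ≡⟨ cong sumℤ (ListP.map-++ f (map (inside ∷_) S) (map (outside ∷_) S)) ⟩
    sumℤ (map f (map (inside ∷_) S) ++ map f (map (outside ∷_) S))
  ≡⟨ sumℤ-++ (map f (map (inside ∷_) S)) _ ⟩
    sumℤ (map f (map (inside ∷_) S)) + sumℤ (map f (map (outside ∷_) S))
  ≡⟨ cong₂ _+_ (cong sumℤ (sym (ListP.map-∘ S))) (cong sumℤ (sym (ListP.map-∘ S))) ⟩
    sumℤ (map (f ∘ (inside ∷_)) S) + sumℤ (map (f ∘ (outside ∷_)) S)
  ≡⟨ cong₂ _+_ (sumℤ-allSubsets n _) (sumℤ-allSubsets n _) ⟩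
    ∑ˢ f
  ∎
  where
  open ≡-Reasoning
  S : List (Subset n)
  S = allSubsets n

negOnePow-+ : ∀ a b → negOnePow (a ℕ.+ b) ≡ negOnePow a * negOnePow b
negOnePow-+ zero b = sym (ℤP.*-identityˡ _)
negOnePow-+ (suc a) b = trans (cong -_ (negOnePow-+ a b)) (ℤP.neg-distribˡ-* (negOnePow a) (negOnePow b))

negOnePow-square : ∀ a → negOnePow a * negOnePow a ≡ + 1
negOnePow-square zero = refl
negOnePow-square (suc a) = trans (neg-square (negOnePow a)) (negOnePow-square a)
  where
  neg-square : ∀ x → - x * - x ≡ x * x
  neg-square = solve-∀

negOnePow-*-cancelˡ : ∀ a {x y} → negOnePow a * x ≡ negOnePow a * y → x ≡ y
negOnePow-*-cancelˡ a {x} {y} eq =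
  begin
    x                                   ≡⟨ sym (trans (cong (_* x) (negOnePow-square a)) (ℤP.*-identityˡ x)) ⟩
    negOnePow a * negOnePow a * x       ≡⟨ ℤP.*-assoc (negOnePow a) _ x ⟩
    negOnePow a * (negOnePow a * x)     ≡⟨ cong (negOnePow a *_) eq ⟩
    negOnePow a * (negOnePow a * y)     ≡⟨ sym (ℤP.*-assoc (negOnePow a) _ y) ⟩
    negOnePow a * negOnePow a * y       ≡⟨ trans (cong (_* y) (negOnePow-square a)) (ℤP.*-identityˡ y) ⟩
    y                                   ∎
  where open ≡-Reasoning

negOnePow-*-cancelʳ : ∀ a {x y} → x * negOnePow a ≡ y * negOnePow a → x ≡ y
negOnePow-*-cancelʳ a {x} {y} eq =
  negOnePow-*-cancelˡ a (trans (ℤP.*-comm (negOnePow a) x) (trans eq (ℤP.*-comm y (negOnePow a))))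

negOnePow-∸-trans : ∀ {a b c} → a ≤ b → b ≤ c → negOnePow (b ∸ a) * negOnePow (c ∸ b) ≡ negOnePow (c ∸ a)
negOnePow-∸-trans {a} {b} {c} a≤b b≤c =
  begin
    negOnePow (b ∸ a) * negOnePow (c ∸ b)  ≡⟨ sym (negOnePow-+ (b ∸ a) (c ∸ b)) ⟩
    negOnePow ((b ∸ a) ℕ.+ (c ∸ b))        ≡⟨ cong negOnePow (ℕP.+-comm (b ∸ a) (c ∸ b)) ⟩
    negOnePow ((c ∸ b) ℕ.+ (b ∸ a))        ≡⟨ cong negOnePow (sym (ℕP.+-∸-assoc (c ∸ b) a≤b)) ⟩
    negOnePow ((c ∸ b) ℕ.+ b ∸ a)          ≡⟨ cong (λ z → negOnePow (z ∸ a)) (ℕP.m∸n+n≡m b≤c) ⟩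
    negOnePow (c ∸ a)                      ∎
  where open ≡-Reasoning

negOnePowℤ-pred : ∀ w → negOnePowℤ (w - + 1) ≡ - negOnePowℤ w
negOnePowℤ-pred (+ zero) = refl
negOnePowℤ-pred (+ suc n) = sym (ℤP.neg-involutive (negOnePow n))
negOnePowℤ-pred ℤ.-[1+ n ] rewrite ℕP.+-identityʳ n = refl

negOnePowℤ-minus : ∀ w f → negOnePowℤ (w - + f) ≡ negOnePowℤ w * negOnePow f
negOnePowℤ-minus w zero = trans (cong negOnePowℤ (ℤP.+-identityʳ w)) (sym (ℤP.*-identityʳ _))
negOnePowℤ-minus w (suc f) =
  begin
    negOnePowℤ (w - + suc f)       ≡⟨ cong negOnePowℤ (shift w (+ f)) ⟩
    negOnePowℤ (w - + f - + 1)     ≡⟨ negOnePowℤ-pred (w - + f) ⟩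
    - negOnePowℤ (w - + f)         ≡⟨ cong -_ (negOnePowℤ-minus w f) ⟩
    - (negOnePowℤ w * negOnePow f) ≡⟨ ℤP.neg-distribʳ-* (negOnePowℤ w) (negOnePow f) ⟩
    negOnePowℤ w * negOnePow (suc f) ∎
  where
  open ≡-Reasoning
  shift : ∀ w x → w - (+ 1 + x) ≡ w - x - + 1
  shift = solve-∀

suc[n∸m]≤o : ∀ {m n o} → m ≤ n → suc n ≤ m ℕ.+ o → suc (n ∸ m) ≤ o
suc[n∸m]≤o {m} {n} {o} m≤n 1+n≤m+o =
  ℕP.+-cancelʳ-≤ m (suc (n ∸ m)) o
    (ℕP.≤-trans (ℕP.≤-reflexive (cong suc (ℕP.m∸n+n≡m m≤n))) (ℕP.≤-trans 1+n≤m+o (ℕP.≤-reflexive (ℕP.+-comm m o))))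

count : ∀ {n p} {P : Fin n → Set p} → (∀ x → Dec (P x)) → ℕ
count {zero} P? = 0
count {suc n} P? = (if does (P? zero) then 1 else 0) ℕ.+ count (P? ∘ suc)

module _ {p : Level} where

  count-≤ : ∀ {n} {P : Fin n → Set p} (P? : ∀ x → Dec (P x)) → count P? ≤ n
  count-≤ {zero} P? = z≤n
  count-≤ {suc n} P? with P? zero
  ... | yes _ = s≤s (count-≤ (P? ∘ suc))
  ... | no _ = ℕP.m≤n⇒m≤1+n (count-≤ (P? ∘ suc))

  count-mono : ∀ {q n} {P : Fin n → Set p} {Q : Fin n → Set q} (P? : ∀ x → Dec (P x)) (Q? : ∀ x → Dec (Q x)) →
               (∀ x → P x → Q x) → count P? ≤ count Q?
  count-mono {n = zero} P? Q? P⇒Q = z≤n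
  count-mono {n = suc n} P? Q? P⇒Q with P? zero | Q? zero
  ... | yes p | yes q = s≤s (count-mono (P? ∘ suc) (Q? ∘ suc) (P⇒Q ∘ suc))
  ... | yes p | no ¬q = ⊥-elim (¬q (P⇒Q zero p))
  ... | no _ | yes q = ℕP.m≤n⇒m≤1+n (count-mono (P? ∘ suc) (Q? ∘ suc) (P⇒Q ∘ suc))
  ... | no _ | no _ = count-mono (P? ∘ suc) (Q? ∘ suc) (P⇒Q ∘ suc)

  count-strict : ∀ {q n} {P : Fin n → Set p} {Q : Fin n → Set q} (P? : ∀ x → Dec (P x)) (Q? : ∀ x → Dec (Q x)) →
                 (∀ x → P x → Q x) → ∀ a → Q a → ¬ P a → count P? < count Q?
  count-strict {n = suc n} P? Q? P⇒Q zero qa ¬pa with P? zero | Q? zero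
  ... | yes p | _ = ⊥-elim (¬pa p)
  ... | no _ | yes q = s≤s (count-mono (P? ∘ suc) (Q? ∘ suc) (P⇒Q ∘ suc))
  ... | no _ | no ¬q = ⊥-elim (¬q qa)
  count-strict {n = suc n} P? Q? P⇒Q (suc a) qa ¬pa with P? zero | Q? zero
  ... | yes p | yes q = s≤s (count-strict (P? ∘ suc) (Q? ∘ suc) (P⇒Q ∘ suc) a qa ¬pa)
  ... | yes p | no ¬q = ⊥-elim (¬q (P⇒Q zero p))
  ... | no _ | yes q = ℕP.m≤n⇒m≤1+n (count-strict (P? ∘ suc) (Q? ∘ suc) (P⇒Q ∘ suc) a qa ¬pa)
  ... | no _ | no _ = count-strict (P? ∘ suc) (Q? ∘ suc) (P⇒Q ∘ suc) a qa ¬pa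

  count-pos : ∀ {n} {P : Fin n → Set p} (P? : ∀ x → Dec (P x)) a → P a → 0 < count P?
  count-pos {suc n} P? zero pa with P? zero
  ... | yes _ = s≤s z≤n
  ... | no ¬pa = ⊥-elim (¬pa pa)
  count-pos {suc n} P? (suc a) pa with P? zero
  ... | yes _ = s≤s z≤n
  ... | no _ = count-pos (P? ∘ suc) a pa

finite-maximum : ∀ {n r s} (R : Fin n → Fin n → Set r) → (∀ {x} → R x x) → (∀ {x y z} → R x y → R y z → R x z) →
  {S : Fin n → Set s} (S? : ∀ x → Dec (S x)) → (∀ x y → S x → S y → R x y ⊎ R y x) →
  ∀ a → S a → Σ (Fin n) λ m → S m × (∀ x → S x → R x m)
finite-maximum {suc n} R refl′ trans′ S? total a sa with FinP.any? (S? ∘ suc)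
... | yes (b , sb) with finite-maximum (λ x y → R (suc x) (suc y)) refl′ trans′ (S? ∘ suc)
                         (λ x y → total (suc x) (suc y)) b sb
...   | m , sm , max with S? zero
...     | no ¬s0 = suc m , sm , λ { zero s0 → ⊥-elim (¬s0 s0) ; (suc x) sx → max x sx }
...     | yes s0 with total zero (suc m) s0 sm
...       | inj₁ 0≤m = suc m , sm , λ { zero _ → 0≤m ; (suc x) sx → max x sx }
...       | inj₂ m≤0 = zero , s0 , λ { zero _ → refl′ ; (suc x) sx → trans′ (max x sx) m≤0 }
finite-maximum {suc n} R refl′ trans′ S? total zero sa | no none =
  zero , sa , λ { zero _ → refl′ ; (suc x) sx → ⊥-elim (none (x , sx)) }
finite-maximum {suc n} R refl′ trans′ S? total (suc a) sa | no none = ⊥-elim (none (a , sa))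

select : ∀ {n p} {Q : Fin n → Set p} → (∀ x → Dec (Q x)) → Subset n
select Q? = Vec.tabulate (does ∘ Q?)

module _ {p : Level} where

  ∈-select⁺ : ∀ {n} {Q : Fin n → Set p} (Q? : ∀ x → Dec (Q x)) {x} → Q x → x ∈ select Q?
  ∈-select⁺ Q? {zero} q with Q? zero
  ... | yes _ = here
  ... | no ¬q = ⊥-elim (¬q q)
  ∈-select⁺ Q? {suc x} q = there (∈-select⁺ (Q? ∘ suc) q)

  ∈-select⁻ : ∀ {n} {Q : Fin n → Set p} (Q? : ∀ x → Dec (Q x)) {x} → x ∈ select Q? → Q x
  ∈-select⁻ Q? {zero} x∈ with Q? zero | x∈
  ... | yes q | _ = q
  ∈-select⁻ Q? {suc x} (there x∈) = ∈-select⁻ (Q? ∘ suc) x∈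

one-element : ∀ {n} (F : Subset n) → 1 ≤ ∣ F ∣ → Σ (Fin n) (_∈ F)
one-element (inside ∷ F) _ = zero , here
one-element (outside ∷ F) h = Data.Product.map suc there (one-element F h)

two-elements : ∀ {n} (F : Subset n) → 2 ≤ ∣ F ∣ → Σ (Fin n) λ x → Σ (Fin n) λ y → x ∈ F × y ∈ F × x ≢ y
two-elements (inside ∷ F) (s≤s 1≤∣F∣) with one-element F 1≤∣F∣
... | y , y∈F = zero , suc y , here , there y∈F , λ ()
two-elements (outside ∷ F) h with two-elements F h
... | x , y , x∈F , y∈F , x≢y = suc x , suc y , there x∈F , there y∈F , x≢y ∘ FinP.suc-injective

two-elements⇒2≤∣∣ : ∀ {n} {F : Subset n} {x y} → x ∈ F → y ∈ F → x ≢ y → 2 ≤ ∣ F ∣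
two-elements⇒2≤∣∣ {F = F} {x} {y} x∈F y∈F x≢y =
  ℕP.≤-trans (s≤s (ℕP.≤-trans (ℕP.≤-reflexive (sym (∣⁅x⁆∣≡1 y))) (p⊆q⇒∣p∣≤∣q∣ ⁅y⁆⊆F∖x)))
             (x∈p⇒∣p-x∣<∣p∣ x∈F)
  where
  ⁅y⁆⊆F∖x : ⁅ y ⁆ ⊆ F ∖ x
  ⁅y⁆⊆F∖x z∈⁅y⁆ rewrite x∈⁅y⁆⇒x≡y y z∈⁅y⁆ = x∈p∧x≢y⇒x∈p-y y∈F (x≢y ∘ sym)

-- Chains of a graded poset

module _ {r : ℕ} (P : GradedPoset r) where
  open GradedPoset P
  open IsPartialOrder isPartialOrder using () renaming (refl to ≼-refl; trans to ≼-trans; antisym to ≼-antisym)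

  private
    V : Set
    V = Fin size
    S : Set
    S = Subset size

  infix 4 _≺_ _≺?_

  _≺_ : V → V → Set
  x ≺ y = x ≼ y × x ≢ y

  _≺?_ : ∀ x y → Dec (x ≺ y)
  x ≺? y = (x ≼? y) ×-dec ¬? (x FinP.≟ y)

  ≺-≼-trans : ∀ {x y z} → x ≺ y → y ≼ z → x ≺ z
  ≺-≼-trans (x≼y , x≢y) y≼z = ≼-trans x≼y y≼z , λ { refl → x≢y (≼-antisym x≼y y≼z) }

  ≺-trans : ∀ {x y z} → x ≺ y → y ≺ z → x ≺ z
  ≺-trans x≺y = ≺-≼-trans x≺y ∘ proj₁

  ≺-irrefl : ∀ {x} → ¬ x ≺ x
  ≺-irrefl (_ , x≢x) = x≢x refl

  ≺⇒⋡ : ∀ {x y} → x ≺ y → ¬ y ≼ x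
  ≺⇒⋡ (x≼y , x≢y) y≼x = x≢y (≼-antisym x≼y y≼x)

  IsChain : S → Set
  IsChain C = ∀ x y → x ∈ C → y ∈ C → x ≼ y ⊎ y ≼ x

  InOpenInterval : V → V → S → Set
  InOpenInterval s t C = ∀ x → x ∈ C → s ≺ x × x ≺ t

  Contains : S → V → V → S → Set
  Contains F s t C = ∀ x → x ∈ F → s ≺ x → x ≺ t → x ∈ C

  ChainThrough : S → V → V → S → Set
  ChainThrough F s t C = InOpenInterval s t C × IsChain C × Contains F s t C

  chainThrough? : ∀ F s t C → Dec (ChainThrough F s t C)
  chainThrough? F s t C =
    FinP.all? (λ x → (x ∈? C) →-dec ((s ≺? x) ×-dec (x ≺? t)))
    ×-dec FinP.all? (λ x → FinP.all? λ y → (x ∈? C) →-dec ((y ∈? C) →-dec ((x ≼? y) ⊎-dec (y ≼? x))))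
    ×-dec FinP.all? (λ x → (x ∈? F) →-dec ((s ≺? x) →-dec ((x ≺? t) →-dec (x ∈? C))))

  -- Σ (-1)^(dim C) over the faces C ⊇ F ∩ (s,t) of the order complex of (s,t); for F = ∅ it is χ̃ of that complex.
  chainχ : S → V → V → ℤ
  chainχ F s t = ∑ˢ (λ C → ⟦ chainThrough? F s t C ⟧· negOnePow (suc ∣ C ∣))

  chainμ : S → V → V → ℤ
  chainμ F s t with s FinP.≟ t
  ... | yes _ = + 1
  ... | no _ = chainχ F s t

  chainμ-refl : ∀ F s → chainμ F s s ≡ + 1
  chainμ-refl F s with s FinP.≟ s
  ... | yes _ = refl
  ... | no s≢s = ⊥-elim (s≢s refl)

  chainμ-≢ : ∀ F {s t} → s ≢ t → chainμ F s t ≡ chainχ F s t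
  chainμ-≢ F {s} {t} s≢t with s FinP.≟ t
  ... | yes s≡t = ⊥-elim (s≢t s≡t)
  ... | no _ = refl

  IsTop : V → S → Set
  IsTop u C = ∀ x → x ∈ C → x ≼ u

  isTop? : ∀ u C → Dec (IsTop u C)
  isTop? u C = FinP.all? (λ x → (x ∈? C) →-dec (x ≼? u))

  AboveAll : S → V → V → V → Set
  AboveAll F s t u = ∀ x → x ∈ F → s ≺ x → x ≺ t → x ≼ u

  aboveAll? : ∀ F s t u → Dec (AboveAll F s t u)
  aboveAll? F s t u = FinP.all? (λ x → (x ∈? F) →-dec ((s ≺? x) →-dec ((x ≺? t) →-dec (x ≼? u))))

  -- u is s itself or the top of a chain of (s,t) through F
  ChainTop : S → V → V → V → Set
  ChainTop F s t u = s ≼ u × u ≺ t × AboveAll F s t u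

  chainTop? : ∀ F s t u → Dec (ChainTop F s t u)
  chainTop? F s t u = (s ≼? u) ×-dec (u ≺? t) ×-dec aboveAll? F s t u

  StrictChainTop : S → V → V → V → Set
  StrictChainTop F s t u = s ≺ u × u ≺ t × AboveAll F s t u

  strictChainTop? : ∀ F s t u → Dec (StrictChainTop F s t u)
  strictChainTop? F s t u = (s ≺? u) ×-dec (u ≺? t) ×-dec aboveAll? F s t u

  ⟦⟧·-split-by-top : ∀ {a} {A : Set a} (d : Dec A) C → (A → IsChain C) → ∀ v →
    ⟦ d ⟧· v ≡ ⟦ d ⟧· ⟦ ¬? (nonempty? C) ⟧· v + sum (λ u → ⟦ u ∈? C ⟧· ⟦ d ⟧· ⟦ isTop? u C ⟧· v)
  ⟦⟧·-split-by-top (no _) C _ v = sym (trans (ℤP.+-identityˡ _) (sum-zero {size} λ u → ⟦⟧·-zero (u ∈? C)))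
  ⟦⟧·-split-by-top (yes a) C chain v with nonempty? C
  ... | no empty = sym (trans (cong (_+_ v) (sum-zero λ u → ⟦⟧·-no (u ∈? C) λ u∈C → empty (u , u∈C)))
                             (ℤP.+-identityʳ v))
  ... | yes (x , x∈C) with finite-maximum _≼_ ≼-refl ≼-trans (_∈? C) (chain a) x x∈C
  ...   | m , m∈C , m-top =
    sym (trans (ℤP.+-identityˡ _)
        (trans (sum-single _ m other-tops-vanish)
               (trans (⟦⟧·-yes (m ∈? C) m∈C) (⟦⟧·-yes (isTop? m C) m-top))))
    where
    other-tops-vanish : ∀ u → u ≢ m → ⟦ u ∈? C ⟧· ⟦ isTop? u C ⟧· v ≡ + 0
    other-tops-vanish u u≢m with u ∈? C
    ... | no _ = refl
    ... | yes u∈C = ⟦⟧·-no (isTop? u C) λ u-top → u≢m (≼-antisym (m-top u u∈C) (u-top m m∈C))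

  module _ (F : S) (s t u : V) (C : S) where

    remove-top : u ∉ C → ChainThrough F s t (insert u C) → IsTop u (insert u C) →
                 StrictChainTop F s t u × ChainThrough F s u C
    remove-top u∉C (in-st , chain , contains) u-top =
      (s≺u , u≺t , λ x x∈F s≺x x≺t → u-top x (contains x x∈F s≺x x≺t)) ,
      (λ x x∈C → proj₁ (in-st x (∈-insert⁺ u C x∈C)) , u-top x (∈-insert⁺ u C x∈C) , λ { refl → u∉C x∈C }) ,
      (λ x y x∈C y∈C → chain x y (∈-insert⁺ u C x∈C) (∈-insert⁺ u C y∈C)) ,
      (λ x x∈F s≺x x≺u → from-insert x≺u (∈-insert⁻ u C (contains x x∈F s≺x (≺-trans x≺u u≺t))))
      where
      s≺u : s ≺ u
      s≺u = proj₁ (in-st u (∈-insert-here u C))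
      u≺t : u ≺ t
      u≺t = proj₂ (in-st u (∈-insert-here u C))
      from-insert : ∀ {x} → x ≺ u → x ≡ u ⊎ x ∈ C → x ∈ C
      from-insert x≺u (inj₁ refl) = ⊥-elim (≺-irrefl x≺u)
      from-insert x≺u (inj₂ x∈C) = x∈C

    insert-top : StrictChainTop F s t u → ChainThrough F s u C →
                 u ∉ C × ChainThrough F s t (insert u C) × IsTop u (insert u C)
    insert-top (s≺u , u≺t , above) (in-su , chain , contains) =
      (λ u∈C → ≺-irrefl (proj₂ (in-su u u∈C))) ,
      ((λ x → in-st ∘ ∈-insert⁻ u C) ,
       (λ x y x∈ y∈ → chain′ (∈-insert⁻ u C x∈) (∈-insert⁻ u C y∈)) ,
       (λ x x∈F s≺x x≺t → contains′ x∈F s≺x (above x x∈F s≺x x≺t) (x FinP.≟ u))) ,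
      (λ x → below-u ∘ ∈-insert⁻ u C)
      where
      in-st : ∀ {x} → x ≡ u ⊎ x ∈ C → s ≺ x × x ≺ t
      in-st (inj₁ refl) = s≺u , u≺t
      in-st (inj₂ x∈C) = proj₁ (in-su _ x∈C) , ≺-trans (proj₂ (in-su _ x∈C)) u≺t
      below-u : ∀ {x} → x ≡ u ⊎ x ∈ C → x ≼ u
      below-u (inj₁ refl) = ≼-refl
      below-u (inj₂ x∈C) = proj₁ (proj₂ (in-su _ x∈C))
      chain′ : ∀ {x y} → x ≡ u ⊎ x ∈ C → y ≡ u ⊎ y ∈ C → x ≼ y ⊎ y ≼ x
      chain′ (inj₂ x∈C) (inj₂ y∈C) = chain _ _ x∈C y∈C
      chain′ x∈ (inj₁ refl) = inj₁ (below-u x∈)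
      chain′ (inj₁ refl) y∈ = inj₂ (below-u y∈)
      contains′ : ∀ {x} → x ∈ F → s ≺ x → x ≼ u → Dec (x ≡ u) → x ∈ insert u C
      contains′ _ _ _ (yes refl) = ∈-insert-here u C
      contains′ x∈F s≺x x≼u (no x≢u) = ∈-insert⁺ u C (contains _ x∈F s≺x (x≼u , x≢u))

  chainχ-by-top : ∀ F s t →
    chainχ F s t ≡ ⟦ chainThrough? F s t ∅ ⟧· - + 1 + sum (λ u → ⟦ strictChainTop? F s t u ⟧· - chainχ F s u)
  chainχ-by-top F s t =
    begin
      chainχ F s t
    ≡⟨ ∑ˢ-cong (λ C → ⟦⟧·-split-by-top (Φ? C) C (proj₁ ∘ proj₂) (w C)) ⟩
      ∑ˢ (λ C → ⟦ Φ? C ⟧· ⟦ ¬? (nonempty? C) ⟧· w C + sum (λ u → ⟦ u ∈? C ⟧· g u ∣ C ∣ C))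
    ≡⟨ ∑ˢ-distrib-+ (λ C → ⟦ Φ? C ⟧· ⟦ ¬? (nonempty? C) ⟧· w C) (λ C → sum (λ u → ⟦ u ∈? C ⟧· g u ∣ C ∣ C)) ⟩
      ∑ˢ (λ C → ⟦ Φ? C ⟧· ⟦ ¬? (nonempty? C) ⟧· w C) + ∑ˢ (λ C → sum (λ u → ⟦ u ∈? C ⟧· g u ∣ C ∣ C))
    ≡⟨ cong₂ _+_ empty-chain (∑ˢ-sum-comm (λ u C → ⟦ u ∈? C ⟧· g u ∣ C ∣ C)) ⟩
      ⟦ Φ? ∅ ⟧· - + 1 + sum (λ u → ∑ˢ (λ C → ⟦ u ∈? C ⟧· g u ∣ C ∣ C))
    ≡⟨ cong (_+_ (⟦ Φ? ∅ ⟧· - + 1)) (sum-cong-≗ chains-with-top) ⟩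
      ⟦ Φ? ∅ ⟧· - + 1 + sum (λ u → ⟦ strictChainTop? F s t u ⟧· - chainχ F s u)
    ∎
    where
    open ≡-Reasoning
    Φ? : ∀ C → Dec (ChainThrough F s t C)
    Φ? = chainThrough? F s t
    w : S → ℤ
    w C = negOnePow (suc ∣ C ∣)
    g : V → ℕ → S → ℤ
    g u m C = ⟦ Φ? C ⟧· ⟦ isTop? u C ⟧· negOnePow (suc m)
    empty-chain : ∑ˢ (λ C → ⟦ Φ? C ⟧· ⟦ ¬? (nonempty? C) ⟧· w C) ≡ ⟦ Φ? ∅ ⟧· - + 1
    empty-chain =
      trans (∑ˢ-single _ ∅ λ C C≢∅ → trans (cong (⟦ Φ? C ⟧·_) (⟦⟧·-no (¬? (nonempty? C)) (C≢∅ ∘ Empty-unique)))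
                                          (⟦⟧·-zero (Φ? C)))
            (cong (⟦ Φ? ∅ ⟧·_) (trans (⟦⟧·-yes (¬? (nonempty? (∅ {size}))) λ { (x , x∈∅) → ∉⊥ x∈∅ })
                                     (cong (negOnePow ∘ suc) (∣⊥∣≡0 size))))
    chains-with-top : ∀ u → ∑ˢ (λ C → ⟦ u ∈? C ⟧· g u ∣ C ∣ C) ≡ ⟦ strictChainTop? F s t u ⟧· - chainχ F s u
    chains-with-top u =
      begin
        ∑ˢ (λ C → ⟦ u ∈? C ⟧· g u ∣ C ∣ C)
      ≡⟨ ∑ˢ-insert u (g u) ⟩
        ∑ˢ (λ C → ⟦ ¬? (u ∈? C) ⟧· ⟦ Φ? (insert u C) ⟧· ⟦ isTop? u (insert u C) ⟧· negOnePow (suc (suc ∣ C ∣)))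
      ≡⟨ ∑ˢ-cong (λ C → ⟦⟧·-cong₃₂ (¬? (u ∈? C)) (Φ? (insert u C)) (isTop? u (insert u C))
                                   (strictChainTop? F s t u) (chainThrough? F s u C)
                                   (λ (u∉C , Φ , top) → remove-top F s t u C u∉C Φ top)
                                   (λ (top , Φ) → insert-top F s t u C top Φ)) ⟩
        ∑ˢ (λ C → ⟦ strictChainTop? F s t u ⟧· ⟦ chainThrough? F s u C ⟧· - negOnePow (suc ∣ C ∣))
      ≡⟨ ∑ˢ-⟦⟧· (strictChainTop? F s t u) (λ C → ⟦ chainThrough? F s u C ⟧· - negOnePow (suc ∣ C ∣)) ⟩
        ⟦ strictChainTop? F s t u ⟧· ∑ˢ (λ C → ⟦ chainThrough? F s u C ⟧· - negOnePow (suc ∣ C ∣))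
      ≡⟨ cong (⟦ strictChainTop? F s t u ⟧·_)
              (trans (∑ˢ-cong λ C → ⟦⟧·-neg (chainThrough? F s u C))
                     (∑ˢ-neg λ C → ⟦ chainThrough? F s u C ⟧· negOnePow (suc ∣ C ∣))) ⟩
        ⟦ strictChainTop? F s t u ⟧· - chainχ F s u
      ∎

  chainχ-recursion : ∀ F {s t} → s ≺ t → chainχ F s t ≡ - sum (λ u → ⟦ chainTop? F s t u ⟧· chainμ F s u)
  chainχ-recursion F {s} {t} s≺t =
    begin
      chainχ F s t
    ≡⟨ chainχ-by-top F s t ⟩
      ⟦ Φ∅? ⟧· - + 1 + sum (λ u → ⟦ strictChainTop? F s t u ⟧· - chainχ F s u)
    ≡⟨ cong₂ _+_ (⟦⟧·-neg Φ∅?) (trans (sum-cong-≗ λ u → ⟦⟧·-neg (strictChainTop? F s t u))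
                                      (sum-neg λ u → ⟦ strictChainTop? F s t u ⟧· chainχ F s u)) ⟩
      - ⟦ Φ∅? ⟧· + 1 + - sum (λ u → ⟦ strictChainTop? F s t u ⟧· chainχ F s u)
    ≡⟨ sym (ℤP.neg-distrib-+ (⟦ Φ∅? ⟧· + 1) (sum λ u → ⟦ strictChainTop? F s t u ⟧· chainχ F s u)) ⟩
      - (⟦ Φ∅? ⟧· + 1 + sum (λ u → ⟦ strictChainTop? F s t u ⟧· chainχ F s u))
    ≡⟨ cong (λ z → - (z + sum (λ u → ⟦ strictChainTop? F s t u ⟧· chainχ F s u)))
            (sym (trans (sum-single (λ u → ⟦ u FinP.≟ s ⟧· ⟦ Φ∅? ⟧· + 1) s λ u u≢s → ⟦⟧·-no (u FinP.≟ s) u≢s)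
                        (⟦⟧·-yes (s FinP.≟ s) refl))) ⟩
      - (sum (λ u → ⟦ u FinP.≟ s ⟧· ⟦ Φ∅? ⟧· + 1) + sum (λ u → ⟦ strictChainTop? F s t u ⟧· chainχ F s u))
    ≡⟨ cong -_ (sym (∑-distrib-+ (λ u → ⟦ u FinP.≟ s ⟧· ⟦ Φ∅? ⟧· + 1)
                                 (λ u → ⟦ strictChainTop? F s t u ⟧· chainχ F s u))) ⟩
      - sum (λ u → ⟦ u FinP.≟ s ⟧· ⟦ Φ∅? ⟧· + 1 + ⟦ strictChainTop? F s t u ⟧· chainχ F s u)
    ≡⟨ cong -_ (sum-cong-≗ (λ u → sym (chainTop-term u (u FinP.≟ s)))) ⟩
      - sum (λ u → ⟦ chainTop? F s t u ⟧· chainμ F s u)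
    ∎
    where
    open ≡-Reasoning
    Φ∅? : Dec (ChainThrough F s t ∅)
    Φ∅? = chainThrough? F s t ∅
    chainTop-term : ∀ u → Dec (u ≡ s) → ⟦ chainTop? F s t u ⟧· chainμ F s u ≡
                    ⟦ u FinP.≟ s ⟧· ⟦ Φ∅? ⟧· + 1 + ⟦ strictChainTop? F s t u ⟧· chainχ F s u
    chainTop-term u (yes refl) =
      begin
        ⟦ chainTop? F s t s ⟧· chainμ F s s
      ≡⟨ ⟦⟧·-cong (chainTop? F s t s) Φ∅? empty-chain-through bottom-as-top (λ _ → chainμ-refl F s) ⟩
        ⟦ Φ∅? ⟧· + 1
      ≡⟨ sym (ℤP.+-identityʳ _) ⟩
        ⟦ Φ∅? ⟧· + 1 + + 0
      ≡⟨ sym (cong₂ _+_ (⟦⟧·-yes (s FinP.≟ s) refl) (⟦⟧·-no (strictChainTop? F s t s) (≺-irrefl ∘ proj₁))) ⟩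
        ⟦ s FinP.≟ s ⟧· ⟦ Φ∅? ⟧· + 1 + ⟦ strictChainTop? F s t s ⟧· chainχ F s s
      ∎
      where
      empty-chain-through : ChainTop F s t s → ChainThrough F s t ∅
      empty-chain-through (_ , _ , above) =
        (λ _ x∈∅ → ⊥-elim (∉⊥ x∈∅)) , (λ _ _ x∈∅ → ⊥-elim (∉⊥ x∈∅)) ,
        λ x x∈F s≺x x≺t → ⊥-elim (≺⇒⋡ s≺x (above x x∈F s≺x x≺t))
      bottom-as-top : ChainThrough F s t ∅ → ChainTop F s t s
      bottom-as-top (_ , _ , contains) = ≼-refl , s≺t , λ x x∈F s≺x x≺t → ⊥-elim (∉⊥ (contains x x∈F s≺x x≺t))
    chainTop-term u (no u≢s) =
      trans (⟦⟧·-cong (chainTop? F s t u) (strictChainTop? F s t u)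
                      (λ (s≼u , rest) → (s≼u , u≢s ∘ sym) , rest) (λ (s≺u , rest) → proj₁ s≺u , rest)
                      (λ _ → chainμ-≢ F (u≢s ∘ sym)))
            (sym (trans (cong (_+ ⟦ strictChainTop? F s t u ⟧· chainχ F s u) (⟦⟧·-no (u FinP.≟ s) u≢s))
                        (ℤP.+-identityˡ _)))

  -- Möbius function and chain sums

  HalfOpen : V → V → V → Set
  HalfOpen s t u = s ≼ u × u ≺ t

  halfOpen? : ∀ s t u → Dec (HalfOpen s t u)
  halfOpen? s t u = (s ≼? u) ×-dec (u ≺? t)

  ∣_,_⟩ : V → V → ℕ
  ∣ s , t ⟩ = count (halfOpen? s t)

  ∣,⟩-shrink-right : ∀ {s u t} → s ≼ u → u ≺ t → ∣ s , u ⟩ < ∣ s , t ⟩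
  ∣,⟩-shrink-right s≼u u≺t =
    count-strict (halfOpen? _ _) (halfOpen? _ _) (λ v (s≼v , v≺u) → s≼v , ≺-trans v≺u u≺t)
                 _ (s≼u , u≺t) (≺-irrefl ∘ proj₂)

  ∣,⟩-shrink-left : ∀ {s m t} → s ≺ m → m ≼ t → ∣ m , t ⟩ < ∣ s , t ⟩
  ∣,⟩-shrink-left s≺m m≼t =
    count-strict (halfOpen? _ _) (halfOpen? _ _) (λ v (m≼v , v≺t) → ≼-trans (proj₁ s≺m) m≼v , v≺t)
                 _ (≼-refl , ≺-≼-trans s≺m m≼t) (λ (m≼s , _) → ≺⇒⋡ s≺m m≼s)

  ∣,⟩-nonempty : ∀ {s t} → s ≺ t → 0 < ∣ s , t ⟩
  ∣,⟩-nonempty {s} {t} s≺t = count-pos (halfOpen? s t) s (≼-refl , s≺t)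

  μ≡chainμ-fuel : ∀ k {s t} → s ≼ t → ∣ s , t ⟩ ≤ k → mobF P k s t ≡ chainμ ∅ s t
  μ≡chainμ-fuel zero {s} {t} s≼t ∣s,t⟩≤0 with s FinP.≟ t
  ... | yes refl = refl
  ... | no s≢t = ⊥-elim (ℕP.<⇒≱ (∣,⟩-nonempty (s≼t , s≢t)) ∣s,t⟩≤0)
  μ≡chainμ-fuel (suc k) {s} {t} s≼t ∣s,t⟩≤k with s FinP.≟ t
  ... | yes refl = refl
  ... | no s≢t with s ≼? t
  ...   | no s⋠t = ⊥-elim (s⋠t s≼t)
  ...   | yes _ =
    begin
      - sumℤ (map (mobF P k s) (filter (halfOpen? s t) (allFin size)))
    ≡⟨ cong -_ (trans (sumℤ-map-filter (halfOpen? s t) (mobF P k s) (allFin size))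
                      (sumℤ-allFin (λ u → ⟦ halfOpen? s t u ⟧· mobF P k s u))) ⟩
      - sum (λ u → ⟦ halfOpen? s t u ⟧· mobF P k s u)
    ≡⟨ cong -_ (sum-cong-≗ λ u → ⟦⟧·-cong (halfOpen? s t u) (chainTop? ∅ s t u)
                                  (λ (s≼u , u≺t) → s≼u , u≺t , λ _ x∈∅ → ⊥-elim (∉⊥ x∈∅))
                                  (λ (s≼u , u≺t , _) → s≼u , u≺t)
                                  (λ (s≼u , u≺t) → μ≡chainμ-fuel k s≼u
                                      (ℕP.≤-pred (ℕP.≤-trans (∣,⟩-shrink-right s≼u u≺t) ∣s,t⟩≤k)))) ⟩
      - sum (λ u → ⟦ chainTop? ∅ s t u ⟧· chainμ ∅ s u)
    ≡⟨ sym (chainχ-recursion ∅ (s≼t , s≢t)) ⟩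
      chainχ ∅ s t
    ∎
    where open ≡-Reasoning

  μ≡chainμ : ∀ {s t} → s ≼ t → μ P s t ≡ chainμ ∅ s t
  μ≡chainμ {s} {t} s≼t = μ≡chainμ-fuel size s≼t (count-≤ (halfOpen? s t))

  chainμ-no-interior : ∀ F {s t} → (∀ x → x ∈ F → s ≺ x → ¬ x ≺ t) → chainμ F s t ≡ chainμ ∅ s t
  chainμ-no-interior F {s} {t} none with s FinP.≟ t
  ... | yes _ = refl
  ... | no _ = ∑ˢ-cong λ C → ⟦⟧·-cong (chainThrough? F s t C) (chainThrough? ∅ s t C)
                 (λ (in-st , chain , _) → in-st , chain , λ _ x∈∅ → ⊥-elim (∉⊥ x∈∅))
                 (λ (in-st , chain , _) → in-st , chain , λ x x∈F s≺x x≺t → ⊥-elim (none x x∈F s≺x x≺t))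
                 (λ _ → refl)

  module _ (F : S) (F-chain : IsChain F) where

    chainμ-split-fuel : ∀ k {s m t} → ∣ m , t ⟩ ≤ k → m ∈ F → s ≺ m → m ≼ t →
                        chainμ F s t ≡ chainμ F s m * chainμ F m t
    chainμ-split-fuel k {s} {m} {t} _ m∈F s≺m m≼t with m FinP.≟ t
    ... | yes refl = sym (ℤP.*-identityʳ _)
    chainμ-split-fuel zero {m = m} {t} ∣m,t⟩≤0 _ _ m≼t | no m≢t =
      ⊥-elim (ℕP.<⇒≱ (∣,⟩-nonempty (m≼t , m≢t)) ∣m,t⟩≤0)
    chainμ-split-fuel (suc k) {s} {m} {t} ∣m,t⟩≤k m∈F s≺m m≼t | no m≢t =
      begin
        chainμ F s t
      ≡⟨ chainμ-≢ F (proj₂ s≺t) ⟩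
        chainχ F s t
      ≡⟨ chainχ-recursion F s≺t ⟩
        - sum (λ u → ⟦ chainTop? F s t u ⟧· chainμ F s u)
      ≡⟨ cong -_ (sum-cong-≗ λ u → ⟦⟧·-cong (chainTop? F s t u) (chainTop? F m t u) ⇒top-above-m top-above-m⇒
                                    (λ top → split-at u (⇒top-above-m top))) ⟩
        - sum (λ u → ⟦ chainTop? F m t u ⟧· (chainμ F s m * chainμ F m u))
      ≡⟨ cong -_ (trans (sum-cong-≗ λ u → ⟦⟧·-*ˡ (chainTop? F m t u) (chainμ F s m))
                        (sym (*-distribˡ-sum (chainμ F s m) λ u → ⟦ chainTop? F m t u ⟧· chainμ F m u))) ⟩
        - (chainμ F s m * sum (λ u → ⟦ chainTop? F m t u ⟧· chainμ F m u))
      ≡⟨ ℤP.neg-distribʳ-* (chainμ F s m) _ ⟩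
        chainμ F s m * - sum (λ u → ⟦ chainTop? F m t u ⟧· chainμ F m u)
      ≡⟨ cong (chainμ F s m *_) (sym (chainχ-recursion F (m≼t , m≢t))) ⟩
        chainμ F s m * chainχ F m t
      ∎
      where
      open ≡-Reasoning
      s≺t : s ≺ t
      s≺t = ≺-≼-trans s≺m m≼t
      ⇒top-above-m : ∀ {u} → ChainTop F s t u → ChainTop F m t u
      ⇒top-above-m (s≼u , u≺t , above) =
        above m m∈F s≺m (m≼t , m≢t) , u≺t , λ x x∈F m≺x x≺t → above x x∈F (≺-trans s≺m m≺x) x≺t
      top-above-m⇒ : ∀ {u} → ChainTop F m t u → ChainTop F s t u
      top-above-m⇒ {u} (m≼u , u≺t , above) = ≼-trans (proj₁ s≺m) m≼u , u≺t , above-s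
        where
        above-s : AboveAll F s t u
        above-s x x∈F s≺x x≺t with F-chain x m x∈F m∈F | x FinP.≟ m
        ... | inj₁ x≼m | _ = ≼-trans x≼m m≼u
        ... | inj₂ _ | yes refl = m≼u
        ... | inj₂ m≼x | no x≢m = above x x∈F (m≼x , x≢m ∘ sym) x≺t
      split-at : ∀ u → ChainTop F m t u → chainμ F s u ≡ chainμ F s m * chainμ F m u
      split-at u (m≼u , u≺t , _) =
        chainμ-split-fuel k (ℕP.≤-pred (ℕP.≤-trans (∣,⟩-shrink-right m≼u u≺t) ∣m,t⟩≤k)) m∈F s≺m m≼u

    chainμ-split : ∀ {s m t} → m ∈ F → s ≺ m → m ≼ t → chainμ F s t ≡ chainμ F s m * chainμ F m t
    chainμ-split {m = m} {t} = chainμ-split-fuel size (count-≤ (halfOpen? m t))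

  infix 4 _⋖_

  _⋖_ : V → V → Set
  a ⋖ b = a ≺ b × (∀ z → a ≼ z → z ≼ b → z ≡ a ⊎ z ≡ b)

  ⋖⇒ρ-suc : ∀ {a b} → a ⋖ b → ρ b ≡ suc (ρ a)
  ⋖⇒ρ-suc ((a≼b , a≢b) , cover) = ρ-cover _ _ a≼b a≢b cover

  ⋖⇒μ≡-1 : ∀ {a b} → a ⋖ b → μ P a b ≡ - + 1
  ⋖⇒μ≡-1 {a} {b} (a≺b , cover) =
    begin
      μ P a b
    ≡⟨ trans (μ≡chainμ (proj₁ a≺b)) (chainμ-≢ ∅ (proj₂ a≺b)) ⟩
      chainχ ∅ a b
    ≡⟨ chainχ-recursion ∅ a≺b ⟩
      - sum (λ u → ⟦ chainTop? ∅ a b u ⟧· chainμ ∅ a u)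
    ≡⟨ cong -_ (sum-single _ a λ u u≢a → ⟦⟧·-no (chainTop? ∅ a b u) λ (a≼u , u≺b , _) → not-between u≢a a≼u u≺b) ⟩
      - ⟦ chainTop? ∅ a b a ⟧· chainμ ∅ a a
    ≡⟨ cong -_ (trans (⟦⟧·-yes (chainTop? ∅ a b a) (≼-refl , a≺b , λ _ x∈∅ → ⊥-elim (∉⊥ x∈∅))) (chainμ-refl ∅ a)) ⟩
      - + 1
    ∎
    where
    open ≡-Reasoning
    not-between : ∀ {u} → u ≢ a → a ≼ u → ¬ u ≺ b
    not-between u≢a a≼u (u≼b , u≢b) with cover _ a≼u u≼b
    ... | inj₁ u≡a = u≢a u≡a
    ... | inj₂ u≡b = u≢b u≡b

  ⋖⇒μ-Eulerian : ∀ {a b} → a ⋖ b → μ P a b ≡ negOnePow (ρ b ∸ ρ a)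
  ⋖⇒μ-Eulerian {a} a⋖b =
    trans (⋖⇒μ≡-1 a⋖b) (cong negOnePow (sym (trans (cong (_∸ ρ a) (⋖⇒ρ-suc a⋖b)) (ℕP.m+n∸n≡m 1 (ρ a)))))

  ρ-strict-fuel : ∀ k {x y} → ∣ x , y ⟩ ≤ k → x ≺ y → ρ x < ρ y
  ρ-strict-fuel k {x} {y} _ x≺y with FinP.any? (λ z → (x ≺? z) ×-dec (z ≺? y))
  ... | no nothing-between = ℕP.≤-reflexive (sym (⋖⇒ρ-suc (x≺y , cover)))
    where
    cover : ∀ z → x ≼ z → z ≼ y → z ≡ x ⊎ z ≡ y
    cover z x≼z z≼y with z FinP.≟ x | z FinP.≟ y
    ... | yes z≡x | _ = inj₁ z≡x
    ... | no _ | yes z≡y = inj₂ z≡y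
    ... | no z≢x | no z≢y = ⊥-elim (nothing-between (z , (x≼z , z≢x ∘ sym) , (z≼y , z≢y)))
  ρ-strict-fuel zero ∣x,y⟩≤0 x≺y | yes _ = ⊥-elim (ℕP.<⇒≱ (∣,⟩-nonempty x≺y) ∣x,y⟩≤0)
  ρ-strict-fuel (suc k) ∣x,y⟩≤k x≺y | yes (z , x≺z , z≺y) =
    ℕP.<-trans (ρ-strict-fuel k (ℕP.≤-pred (ℕP.≤-trans (∣,⟩-shrink-right (proj₁ x≺z) z≺y) ∣x,y⟩≤k)) x≺z)
               (ρ-strict-fuel k (ℕP.≤-pred (ℕP.≤-trans (∣,⟩-shrink-left x≺z (proj₁ z≺y)) ∣x,y⟩≤k)) z≺y)

  ρ-strict : ∀ {x y} → x ≺ y → ρ x < ρ y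
  ρ-strict {x} {y} = ρ-strict-fuel size (count-≤ (halfOpen? x y))

  ρ-mono : ∀ {x y} → x ≼ y → ρ x ≤ ρ y
  ρ-mono {x} {y} x≼y with x FinP.≟ y
  ... | yes refl = ℕP.≤-refl
  ... | no x≢y = ℕP.<⇒≤ (ρ-strict (x≼y , x≢y))

  bot≺ : ∀ {x} → x ≢ bot → bot ≺ x
  bot≺ x≢bot = bot-min _ , x≢bot ∘ sym

  ≺top : ∀ {x} → x ≢ top → x ≺ top
  ≺top x≢top = top-max _ , x≢top

  -- The link of a face

  χ̃-link : ∀ F → IsFace P F → χ̃ (inLink? P F) ≡ negOnePow ∣ F ∣ * chainχ F bot top
  χ̃-link F F-face =
    begin
      χ̃ (inLink? P F)
    ≡⟨ trans (sumℤ-map-filter (inLink? P F) (negOnePowℤ ∘ dimℤ) (allSubsets size)) (sumℤ-allSubsets size _) ⟩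
      ∑ˢ (λ G → ⟦ inLink? P F G ⟧· negOnePowℤ (dimℤ G))
    ≡⟨ ∑ˢ-cong link-term ⟩
      ∑ˢ (λ G → ⟦ F ⊆? ∁ G ⟧· (negOnePow ∣ G ∣ * k (F ∪ G)))
    ≡⟨ ∑ˢ-disjoint-∪ F k ⟩
      negOnePow ∣ F ∣ * ∑ˢ (λ C → ⟦ F ⊆? C ⟧· (negOnePow ∣ C ∣ * k C))
    ≡⟨ cong (negOnePow ∣ F ∣ *_) (∑ˢ-cong chain-term) ⟩
      negOnePow ∣ F ∣ * chainχ F bot top
    ∎
    where
    open ≡-Reasoning
    k : S → ℤ
    k C = ⟦ isFace? P C ⟧· - + 1
    neg-as-* : ∀ y → - y ≡ y * - + 1
    neg-as-* y = sym (trans (ℤP.*-comm y (- + 1)) (ℤP.-1*i≡-i y))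
    link-term : ∀ G → ⟦ inLink? P F G ⟧· negOnePowℤ (dimℤ G) ≡ ⟦ F ⊆? ∁ G ⟧· (negOnePow ∣ G ∣ * k (F ∪ G))
    link-term G =
      begin
        ⟦ isFace? P (F ∪ G) ×-dec disjoint? P F G ⟧· negOnePowℤ (+ ∣ G ∣ - + 1)
      ≡⟨ trans (⟦⟧·-× (isFace? P (F ∪ G)) (disjoint? P F G)) (⟦⟧·-comm (isFace? P (F ∪ G)) (disjoint? P F G)) ⟩
        ⟦ disjoint? P F G ⟧· ⟦ isFace? P (F ∪ G) ⟧· negOnePowℤ (+ ∣ G ∣ - + 1)
      ≡⟨ ⟦⟧·-cong (disjoint? P F G) (F ⊆? ∁ G) (λ disj x∈F → x∉p⇒x∈∁p (disj _ x∈F)) (λ F⊆∁G x x∈F → x∈∁p⇒x∉p (F⊆∁G x∈F))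
                  (λ _ → cong (⟦ isFace? P (F ∪ G) ⟧·_) (trans (negOnePowℤ-pred (+ ∣ G ∣)) (neg-as-* (negOnePow ∣ G ∣)))) ⟩
        ⟦ F ⊆? ∁ G ⟧· ⟦ isFace? P (F ∪ G) ⟧· (negOnePow ∣ G ∣ * - + 1)
      ≡⟨ cong (⟦ F ⊆? ∁ G ⟧·_) (⟦⟧·-*ˡ (isFace? P (F ∪ G)) (negOnePow ∣ G ∣)) ⟩
        ⟦ F ⊆? ∁ G ⟧· (negOnePow ∣ G ∣ * k (F ∪ G))
      ∎
    chain-term : ∀ C → ⟦ F ⊆? C ⟧· (negOnePow ∣ C ∣ * k C) ≡ ⟦ chainThrough? F bot top C ⟧· negOnePow (suc ∣ C ∣)
    chain-term C =
      begin
        ⟦ F ⊆? C ⟧· (negOnePow ∣ C ∣ * k C)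
      ≡⟨ cong (⟦ F ⊆? C ⟧·_) (sym (⟦⟧·-*ˡ (isFace? P C) (negOnePow ∣ C ∣))) ⟩
        ⟦ F ⊆? C ⟧· ⟦ isFace? P C ⟧· (negOnePow ∣ C ∣ * - + 1)
      ≡⟨ sym (⟦⟧·-× (F ⊆? C) (isFace? P C)) ⟩
        ⟦ (F ⊆? C) ×-dec isFace? P C ⟧· (negOnePow ∣ C ∣ * - + 1)
      ≡⟨ ⟦⟧·-cong ((F ⊆? C) ×-dec isFace? P C) (chainThrough? F bot top C) face⇒chain chain⇒face
                  (λ _ → sym (neg-as-* (negOnePow ∣ C ∣))) ⟩
        ⟦ chainThrough? F bot top C ⟧· negOnePow (suc ∣ C ∣)
      ∎
      where
      face⇒chain : F ⊆ C × IsFace P C → ChainThrough F bot top C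
      face⇒chain (F⊆C , proper , chain) =
        (λ x x∈C → bot≺ (proj₁ (proper x x∈C)) , ≺top (proj₂ (proper x x∈C))) , chain , λ _ x∈F _ _ → F⊆C x∈F
      chain⇒face : ChainThrough F bot top C → F ⊆ C × IsFace P C
      chain⇒face (in-open , chain , contains) =
        (λ {x} x∈F → contains x x∈F (bot≺ (proj₁ (proj₁ F-face x x∈F))) (≺top (proj₂ (proj₁ F-face x x∈F)))) ,
        (λ x x∈C → proj₂ (proj₁ (in-open x x∈C)) ∘ sym , proj₂ (proj₂ (in-open x x∈C))) , chain

  Lower Upper : S → V → Set
  Lower F a = a ≡ bot ⊎ a ∈ F
  Upper F b = b ≡ top ⊎ b ∈ F

  lower-∈ : ∀ {F a} → Lower F a → a ≢ bot → a ∈ F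
  lower-∈ (inj₁ a≡bot) a≢bot = ⊥-elim (a≢bot a≡bot)
  lower-∈ (inj₂ a∈F) _ = a∈F

  upper-∈ : ∀ {F b} → Upper F b → b ≢ top → b ∈ F
  upper-∈ (inj₁ b≡top) b≢top = ⊥-elim (b≢top b≡top)
  upper-∈ (inj₂ b∈F) _ = b∈F

  NoneBetween : S → V → V → Set
  NoneBetween F a b = ∀ x → x ∈ F → a ≺ x → ¬ x ≺ b

  -- consecutive elements of the chain F ∪ {0̂,1̂}
  Segment : S → V → V → Set
  Segment F a b = Lower F a × Upper F b × a ≺ b × NoneBetween F a b

  segment-outside : ∀ {F a b} → IsFace P F → Segment F a b → ∀ {f} → f ∈ F → f ≼ a ⊎ b ≼ f
  segment-outside {F} {a} {b} (_ , F-chain) (lower , upper , _ , none) {f} f∈F with f ≼? a | b ≼? f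
  ... | yes f≼a | _ = inj₁ f≼a
  ... | no _ | yes b≼f = inj₂ b≼f
  ... | no f⋠a | no b⋠f = ⊥-elim (none f f∈F (a≼f lower , λ { refl → f⋠a ≼-refl }) (f≼b upper , λ { refl → b⋠f ≼-refl }))
    where
    a≼f : Lower F a → a ≼ f
    a≼f (inj₁ refl) = bot-min f
    a≼f (inj₂ a∈F) with F-chain a f a∈F f∈F
    ... | inj₁ a≼f = a≼f
    ... | inj₂ f≼a = ⊥-elim (f⋠a f≼a)
    f≼b : Upper F b → f ≼ b
    f≼b (inj₁ refl) = top-max f
    f≼b (inj₂ b∈F) with F-chain f b f∈F b∈F
    ... | inj₁ f≼b = f≼b
    ... | inj₂ b≼f = ⊥-elim (b⋠f b≼f)

  module _ (F : S) (F-face : IsFace P F) where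

    private
      Interior : V → V → V → Set
      Interior s t x = x ∈ F × s ≺ x × x ≺ t

      interior? : ∀ s t x → Dec (Interior s t x)
      interior? s t x = (x ∈? F) ×-dec (s ≺? x) ×-dec (x ≺? t)

    EulerianSegmentsIn : V → V → Set
    EulerianSegmentsIn s t = ∀ {a b} → s ≼ a → b ≼ t → Segment F a b → μ P a b ≡ negOnePow (ρ b ∸ ρ a)

    chainμ-Eulerian-fuel : ∀ k {s t} → count (interior? s t) ≤ k → Lower F s → Upper F t → s ≼ t →
                           EulerianSegmentsIn s t → chainμ F s t ≡ negOnePow (ρ t ∸ ρ s)
    chainμ-Eulerian-fuel k {s} {t} _ lower upper s≼t Eulerian with FinP.any? (interior? s t)
    ... | no no-interior = no-interior-case (s FinP.≟ t)
      where
      none : NoneBetween F s t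
      none x x∈F s≺x x≺t = no-interior (x , x∈F , s≺x , x≺t)
      no-interior-case : Dec (s ≡ t) → chainμ F s t ≡ negOnePow (ρ t ∸ ρ s)
      no-interior-case (yes refl) = trans (chainμ-refl F s) (cong negOnePow (sym (ℕP.n∸n≡0 (ρ s))))
      no-interior-case (no s≢t) =
        begin
          chainμ F s t  ≡⟨ chainμ-no-interior F none ⟩
          chainμ ∅ s t  ≡⟨ sym (μ≡chainμ s≼t) ⟩
          μ P s t       ≡⟨ Eulerian ≼-refl ≼-refl (lower , upper , (s≼t , s≢t) , none) ⟩
          negOnePow (ρ t ∸ ρ s) ∎
        where open ≡-Reasoning
    chainμ-Eulerian-fuel zero ∣int∣≤0 _ _ _ _ | yes (x , x-int) =
      ⊥-elim (ℕP.<⇒≱ (count-pos (interior? _ _) x x-int) ∣int∣≤0)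
    chainμ-Eulerian-fuel (suc k) {s} {t} ∣int∣≤k lower upper s≼t Eulerian | yes (x , x-int)
      with finite-maximum _≼_ ≼-refl ≼-trans (interior? s t)
                          (λ x y x-int y-int → proj₂ F-face x y (proj₁ x-int) (proj₁ y-int)) x x-int
    ... | m , (m∈F , s≺m , m≺t) , m-max =
      begin
        chainμ F s t
      ≡⟨ chainμ-split F (proj₂ F-face) m∈F s≺m (proj₁ m≺t) ⟩
        chainμ F s m * chainμ F m t
      ≡⟨ cong₂ _*_ (chainμ-Eulerian-fuel k ∣int∣-shrinks lower (inj₂ m∈F) (proj₁ s≺m)
                                          (λ s≼a b≼m → Eulerian s≼a (≼-trans b≼m (proj₁ m≺t))))
                   last-segment ⟩
        negOnePow (ρ m ∸ ρ s) * negOnePow (ρ t ∸ ρ m)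
      ≡⟨ negOnePow-∸-trans (ρ-mono (proj₁ s≺m)) (ρ-mono (proj₁ m≺t)) ⟩
        negOnePow (ρ t ∸ ρ s)
      ∎
      where
      open ≡-Reasoning
      none : NoneBetween F m t
      none x x∈F m≺x x≺t = ≺⇒⋡ m≺x (m-max x (x∈F , ≺-trans s≺m m≺x , x≺t))
      last-segment : chainμ F m t ≡ negOnePow (ρ t ∸ ρ m)
      last-segment =
        trans (chainμ-no-interior F none)
              (trans (sym (μ≡chainμ (proj₁ m≺t))) (Eulerian (proj₁ s≺m) ≼-refl (inj₂ m∈F , upper , m≺t , none)))
      ∣int∣-shrinks : count (interior? s m) ≤ k
      ∣int∣-shrinks =
        ℕP.≤-pred (ℕP.≤-trans (count-strict (interior? s m) (interior? s t) (λ x (x∈F , s≺x , x≺m) → x∈F , s≺x , ≺-trans x≺m m≺t)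
                                            m (m∈F , s≺m , m≺t) (≺-irrefl ∘ proj₂ ∘ proj₂))
                              ∣int∣≤k)

    chainμ-Eulerian : ∀ {s t} → Lower F s → Upper F t → s ≼ t → EulerianSegmentsIn s t →
                      chainμ F s t ≡ negOnePow (ρ t ∸ ρ s)
    chainμ-Eulerian {s} {t} = chainμ-Eulerian-fuel size (count-≤ (interior? s t))

    chainμ-split-lower : ∀ {m} → Lower F m → chainμ F bot top ≡ chainμ F bot m * chainμ F m top
    chainμ-split-lower (inj₁ refl) = sym (trans (cong (_* chainμ F bot top) (chainμ-refl F bot)) (ℤP.*-identityˡ _))
    chainμ-split-lower (inj₂ m∈F) = chainμ-split F (proj₂ F-face) m∈F (bot≺ (proj₁ (proj₁ F-face _ m∈F))) (top-max _)

    chainμ-split-upper : ∀ {s m} → s ≺ m → Upper F m → chainμ F s top ≡ chainμ F s m * chainμ F m top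
    chainμ-split-upper {s} _ (inj₁ refl) = sym (trans (cong (chainμ F s top *_) (chainμ-refl F top)) (ℤP.*-identityʳ _))
    chainμ-split-upper s≺m (inj₂ m∈F) = chainμ-split F (proj₂ F-face) m∈F s≺m (top-max _)

  segment? : ∀ F a b → Dec (Segment F a b)
  segment? F a b =
    ((a FinP.≟ bot) ⊎-dec (a ∈? F)) ×-dec ((b FinP.≟ top) ⊎-dec (b ∈? F)) ×-dec (a ≺? b)
    ×-dec FinP.all? (λ x → (x ∈? F) →-dec ((a ≺? x) →-dec ¬? (x ≺? b)))

  lower-comparable : ∀ {F a a′} → IsChain F → Lower F a → Lower F a′ → a ≼ a′ ⊎ a′ ≼ a
  lower-comparable _ (inj₁ refl) _ = inj₁ (bot-min _)
  lower-comparable _ (inj₂ _) (inj₁ refl) = inj₂ (bot-min _)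
  lower-comparable F-chain (inj₂ a∈F) (inj₂ a′∈F) = F-chain _ _ a∈F a′∈F

  upper-comparable : ∀ {F b b′} → IsChain F → Upper F b → Upper F b′ → b ≼ b′ ⊎ b′ ≼ b
  upper-comparable _ (inj₁ refl) _ = inj₂ (top-max _)
  upper-comparable _ (inj₂ _) (inj₁ refl) = inj₁ (top-max _)
  upper-comparable F-chain (inj₂ b∈F) (inj₂ b′∈F) = F-chain _ _ b∈F b′∈F

  segment-above : ∀ {F a} → IsChain F → Lower F a → a ≺ top → Σ V (Segment F a)
  segment-above {F} {a} F-chain lower a≺top
    with finite-maximum (λ x y → y ≼ x) ≼-refl (λ y≼x z≼y → ≼-trans z≼y y≼x)
                        (λ y → ((y FinP.≟ top) ⊎-dec (y ∈? F)) ×-dec (a ≺? y))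
                        (λ x y (x-up , _) (y-up , _) → upper-comparable F-chain y-up x-up)
                        top (inj₁ refl , a≺top)
  ... | b , (upper , a≺b) , b-min =
    b , lower , upper , a≺b , λ x x∈F a≺x x≺b → ≺⇒⋡ x≺b (b-min x (inj₂ x∈F , a≺x))

  segment-below : ∀ {F b} → IsChain F → Upper F b → bot ≺ b → Σ V (λ a → Segment F a b)
  segment-below {F} {b} F-chain upper bot≺b
    with finite-maximum _≼_ ≼-refl ≼-trans
                        (λ x → ((x FinP.≟ bot) ⊎-dec (x ∈? F)) ×-dec (x ≺? b))
                        (λ x y (x-low , _) (y-low , _) → lower-comparable F-chain x-low y-low)
                        bot (inj₁ refl , bot≺b)
  ... | a , (lower , a≺b) , a-max =
    a , lower , upper , a≺b , λ x x∈F a≺x x≺b → ≺⇒⋡ a≺x (a-max x (inj₂ x∈F , x≺b))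

  module _ (u v : V) (u≺v : u ≺ v) where

    Refinement : S → Set
    Refinement F = IsFace P F × Segment F u v × (∀ {a b} → Segment F a b → b ≼ u ⊎ v ≼ a → a ⋖ b)

    private
      Splittable : S → V → V → V → Set
      Splittable F a b z = Segment F a b × (b ≼ u ⊎ v ≼ a) × a ≺ z × z ≺ b

      splittable? : ∀ F a b z → Dec (Splittable F a b z)
      splittable? F a b z = segment? F a b ×-dec ((b ≼? u) ⊎-dec (v ≼? a)) ×-dec (a ≺? z) ×-dec (z ≺? b)

      outside? : ∀ (F : S) x → Dec (x ∉ F)
      outside? F x = ¬? (x ∈? F)

    insert-face : ∀ {F a b z} → IsFace P F → Segment F a b → a ≺ z → z ≺ b → IsFace P (insert z F)
    insert-face {F} {a} {b} {z} F-face@(proper , F-chain) seg a≺z z≺b =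
      (λ x → proper′ ∘ ∈-insert⁻ z F) , λ x y x∈ y∈ → chain′ (∈-insert⁻ z F x∈) (∈-insert⁻ z F y∈)
      where
      proper′ : ∀ {x} → x ≡ z ⊎ x ∈ F → x ≢ bot × x ≢ top
      proper′ (inj₁ refl) = (λ { refl → ≺⇒⋡ a≺z (bot-min a) }) , (λ { refl → ≺⇒⋡ z≺b (top-max b) })
      proper′ (inj₂ x∈F) = proper _ x∈F
      z-comparable : ∀ {x} → x ∈ F → x ≼ z ⊎ z ≼ x
      z-comparable x∈F with segment-outside F-face seg x∈F
      ... | inj₁ x≼a = inj₁ (≼-trans x≼a (proj₁ a≺z))
      ... | inj₂ b≼x = inj₂ (≼-trans (proj₁ z≺b) b≼x)
      chain′ : ∀ {x y} → x ≡ z ⊎ x ∈ F → y ≡ z ⊎ y ∈ F → x ≼ y ⊎ y ≼ x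
      chain′ (inj₁ refl) (inj₁ refl) = inj₁ ≼-refl
      chain′ (inj₁ refl) (inj₂ y∈F) with z-comparable y∈F
      ... | inj₁ y≼z = inj₂ y≼z
      ... | inj₂ z≼y = inj₁ z≼y
      chain′ (inj₂ x∈F) (inj₁ refl) = z-comparable x∈F
      chain′ (inj₂ x∈F) (inj₂ y∈F) = F-chain _ _ x∈F y∈F

    insert-keeps-segment : ∀ {F a b z} → Segment F u v → b ≼ u ⊎ v ≼ a → a ≺ z → z ≺ b → Segment (insert z F) u v
    insert-keeps-segment {F} {a} {b} {z} (lower , upper , _ , none) beyond-uv a≺z z≺b =
      lower′ lower , upper′ upper , u≺v , λ x → none′ ∘ ∈-insert⁻ z F
      where
      lower′ : Lower F u → Lower (insert z F) u
      lower′ (inj₁ u≡bot) = inj₁ u≡bot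
      lower′ (inj₂ u∈F) = inj₂ (∈-insert⁺ z F u∈F)
      upper′ : Upper F v → Upper (insert z F) v
      upper′ (inj₁ v≡top) = inj₁ v≡top
      upper′ (inj₂ v∈F) = inj₂ (∈-insert⁺ z F v∈F)
      none′ : ∀ {x} → x ≡ z ⊎ x ∈ F → u ≺ x → ¬ x ≺ v
      none′ (inj₁ refl) u≺z z≺v =
        [ ≺⇒⋡ (≺-trans u≺z z≺b) , ≺⇒⋡ (≺-trans a≺z z≺v) ]′ beyond-uv
      none′ (inj₂ x∈F) = none _ x∈F

    refine-fuel : ∀ k F → count (outside? F) ≤ k → IsFace P F → Segment F u v → Σ S Refinement
    refine-fuel k F _ F-face seg-uv
      with FinP.any? (λ a → FinP.any? λ b → FinP.any? λ z → splittable? F a b z)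
    ... | no unsplittable = F , F-face , seg-uv , covers
      where
      covers : ∀ {a b} → Segment F a b → b ≼ u ⊎ v ≼ a → a ⋖ b
      covers {a} {b} seg beyond-uv = proj₁ (proj₂ (proj₂ seg)) , cover
        where
        cover : ∀ z → a ≼ z → z ≼ b → z ≡ a ⊎ z ≡ b
        cover z a≼z z≼b with z FinP.≟ a | z FinP.≟ b
        ... | yes z≡a | _ = inj₁ z≡a
        ... | no _ | yes z≡b = inj₂ z≡b
        ... | no z≢a | no z≢b = ⊥-elim (unsplittable (a , b , z , seg , beyond-uv , (a≼z , z≢a ∘ sym) , (z≼b , z≢b)))
    refine-fuel zero F ∣out∣≤0 _ _ | yes (a , b , z , seg , _ , a≺z , z≺b) =
      ⊥-elim (ℕP.<⇒≱ (count-pos (outside? F) z λ z∈F → proj₂ (proj₂ (proj₂ seg)) z z∈F a≺z z≺b) ∣out∣≤0)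
    refine-fuel (suc k) F ∣out∣≤k F-face seg-uv | yes (a , b , z , seg , beyond-uv , a≺z , z≺b) =
      refine-fuel k (insert z F) ∣out∣-shrinks (insert-face F-face seg a≺z z≺b)
                  (insert-keeps-segment seg-uv beyond-uv a≺z z≺b)
      where
      ∣out∣-shrinks : count (outside? (insert z F)) ≤ k
      ∣out∣-shrinks =
        ℕP.≤-pred (ℕP.≤-trans (count-strict (outside? (insert z F)) (outside? F) (λ x x∉ x∈F → x∉ (∈-insert⁺ z F x∈F))
                                            z (λ z∈F → proj₂ (proj₂ (proj₂ seg)) z z∈F a≺z z≺b)
                                            (λ z∉ → z∉ (∈-insert-here z F)))
                              ∣out∣≤k)

    refinement : Σ S Refinement
    refinement = refine-fuel size F₀ (count-≤ (outside? F₀)) F₀-face F₀-segment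
      where
      ProperEnd : V → Set
      ProperEnd x = (x ≡ u ⊎ x ≡ v) × x ≢ bot × x ≢ top
      properEnd? : ∀ x → Dec (ProperEnd x)
      properEnd? x = ((x FinP.≟ u) ⊎-dec (x FinP.≟ v)) ×-dec ¬? (x FinP.≟ bot) ×-dec ¬? (x FinP.≟ top)
      F₀ : S
      F₀ = select properEnd?
      member : ∀ {x} → x ∈ F₀ → ProperEnd x
      member = ∈-select⁻ properEnd?
      F₀-face : IsFace P F₀
      F₀-face = (λ x → proj₂ ∘ member) , λ x y x∈ y∈ → comparable (proj₁ (member x∈)) (proj₁ (member y∈))
        where
        comparable : ∀ {x y} → x ≡ u ⊎ x ≡ v → y ≡ u ⊎ y ≡ v → x ≼ y ⊎ y ≼ x
        comparable (inj₁ refl) (inj₁ refl) = inj₁ ≼-refl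
        comparable (inj₁ refl) (inj₂ refl) = inj₁ (proj₁ u≺v)
        comparable (inj₂ refl) (inj₁ refl) = inj₂ (proj₁ u≺v)
        comparable (inj₂ refl) (inj₂ refl) = inj₁ ≼-refl
      F₀-segment : Segment F₀ u v
      F₀-segment = lower (u FinP.≟ bot) , upper (v FinP.≟ top) , u≺v , λ x x∈ → none (proj₁ (member x∈))
        where
        lower : Dec (u ≡ bot) → Lower F₀ u
        lower (yes u≡bot) = inj₁ u≡bot
        lower (no u≢bot) = inj₂ (∈-select⁺ properEnd? (inj₁ refl , u≢bot , λ { refl → ≺⇒⋡ u≺v (top-max v) }))
        upper : Dec (v ≡ top) → Upper F₀ v
        upper (yes v≡top) = inj₁ v≡top
        upper (no v≢top) = inj₂ (∈-select⁺ properEnd? (inj₂ refl , (λ { refl → ≺⇒⋡ u≺v (bot-min u) }) , v≢top))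
        none : ∀ {x} → x ≡ u ⊎ x ≡ v → u ≺ x → ¬ x ≺ v
        none (inj₁ refl) u≺u _ = ≺-irrefl u≺u
        none (inj₂ refl) _ v≺v = ≺-irrefl v≺v

    refinement-factorization : ∀ {G} → Refinement G →
                               chainμ G bot top ≡ negOnePow (ρ u ∸ ρ bot) * (μ P u v * negOnePow (ρ top ∸ ρ v))
    refinement-factorization {G} (G-face , (lower , upper , _ , none) , covers) =
      begin
        chainμ G bot top                                 ≡⟨ chainμ-split-lower G G-face lower ⟩
        chainμ G bot u * chainμ G u top                  ≡⟨ cong (chainμ G bot u *_) (chainμ-split-upper G G-face u≺v upper) ⟩
        chainμ G bot u * (chainμ G u v * chainμ G v top) ≡⟨ cong₂ _*_ (below ≼-refl lower) (cong₂ _*_ between (above ≼-refl upper)) ⟩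
        negOnePow (ρ u ∸ ρ bot) * (μ P u v * negOnePow (ρ top ∸ ρ v)) ∎
      where
      open ≡-Reasoning
      below : ∀ {x} → x ≼ u → Lower G x → chainμ G bot x ≡ negOnePow (ρ x ∸ ρ bot)
      below _ (inj₁ refl) = trans (chainμ-refl G bot) (cong negOnePow (sym (ℕP.n∸n≡0 (ρ bot))))
      below x≼u (inj₂ x∈G) = chainμ-Eulerian G G-face (inj₁ refl) (inj₂ x∈G) (bot-min _)
                               λ _ b≼x seg → ⋖⇒μ-Eulerian (covers seg (inj₁ (≼-trans b≼x x≼u)))
      above : ∀ {y} → v ≼ y → Upper G y → chainμ G y top ≡ negOnePow (ρ top ∸ ρ y)
      above _ (inj₁ refl) = trans (chainμ-refl G top) (cong negOnePow (sym (ℕP.n∸n≡0 (ρ top))))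
      above v≼y (inj₂ y∈G) = chainμ-Eulerian G G-face (inj₂ y∈G) (inj₁ refl) (top-max _)
                               λ y≼a _ seg → ⋖⇒μ-Eulerian (covers seg (inj₂ (≼-trans v≼y y≼a)))
      between : chainμ G u v ≡ μ P u v
      between = trans (chainμ-no-interior G none) (sym (μ≡chainμ (proj₁ u≺v)))

  module _ {d : ℕ} (ρ-top≡1+d : ρ top ≡ suc d) where

    ρ≤1+d : ∀ x → ρ x ≤ suc d
    ρ≤1+d x = ℕP.≤-trans (ρ-mono (top-max x)) (ℕP.≤-reflexive ρ-top≡1+d)

    ρ≤d : ∀ {x} → x ≢ top → ρ x ≤ d
    ρ≤d x≢top = ℕP.≤-pred (ℕP.≤-trans (ρ-strict (≺top x≢top)) (ℕP.≤-reflexive ρ-top≡1+d))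

    1≤ρ : ∀ {x} → x ≢ bot → 1 ≤ ρ x
    1≤ρ x≢bot = ℕP.≤-trans (ℕP.≤-reflexive (cong suc (sym ρ-bot))) (ρ-strict (bot≺ x≢bot))

    bot≢top : bot ≢ top
    bot≢top bot≡top with trans (trans (sym ρ-bot) (cong ρ bot≡top)) ρ-top≡1+d
    ... | ()

    link-sign : ∀ f → negOnePowℤ ((+ d - + 1) - + f) ≡ negOnePow f * negOnePow (ρ top ∸ ρ bot)
    link-sign f =
      begin
        negOnePowℤ ((+ d - + 1) - + f)          ≡⟨ negOnePowℤ-minus (+ d - + 1) f ⟩
        negOnePowℤ (+ d - + 1) * negOnePow f    ≡⟨ cong (_* negOnePow f) (negOnePowℤ-pred (+ d)) ⟩
        negOnePow (suc d) * negOnePow f         ≡⟨ ℤP.*-comm (negOnePow (suc d)) (negOnePow f) ⟩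
        negOnePow f * negOnePow (suc d)         ≡⟨ cong (λ k → negOnePow f * negOnePow k) (sym (cong₂ _∸_ ρ-top≡1+d ρ-bot)) ⟩
        negOnePow f * negOnePow (ρ top ∸ ρ bot) ∎
      where open ≡-Reasoning

    χ̃-link-chainμ : ∀ F → IsFace P F → χ̃ (inLink? P F) ≡ negOnePow ∣ F ∣ * chainμ F bot top
    χ̃-link-chainμ F F-face = trans (χ̃-link F F-face) (cong (negOnePow ∣ F ∣ *_) (sym (chainμ-≢ F bot≢top)))

    -- Two elements p ≺ q of F lie strictly between 0̂ and 1̂ and outside (a,b), so [a,b] misses two rank steps.
    segment-length : ∀ {F a b} → IsFace P F → 2 ≤ ∣ F ∣ → Segment F a b → suc (ρ b ∸ ρ a) ≤ d
    segment-length {F} {a} {b} F-face@(proper , F-chain) 2≤∣F∣ seg@(_ , _ , a≺b , _) =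
      ordered (two-elements F 2≤∣F∣)
      where
      ρa≤ρb : ρ a ≤ ρ b
      ρa≤ρb = ρ-mono (proj₁ a≺b)
      bound : ∀ {p q} → p ≺ q → p ∈ F → q ∈ F → suc (ρ b ∸ ρ a) ≤ d
      bound {p} {q} p≺q p∈F q∈F with segment-outside F-face seg p∈F | segment-outside F-face seg q∈F
      ... | inj₁ p≼a | inj₁ q≼a =
        suc[n∸m]≤o ρa≤ρb (ℕP.≤-trans (s≤s (ρ≤1+d b))
                                  (ℕP.+-monoˡ-≤ d (ℕP.≤-trans (s≤s (1≤ρ (proj₁ (proper p p∈F))))
                                                             (ℕP.≤-trans (ρ-strict p≺q) (ρ-mono q≼a)))))
      ... | inj₁ p≼a | inj₂ b≼q =
        suc[n∸m]≤o ρa≤ρb (ℕP.+-mono-≤ (ℕP.≤-trans (1≤ρ (proj₁ (proper p p∈F))) (ρ-mono p≼a))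
                                   (ℕP.≤-trans (ρ-mono b≼q) (ρ≤d (proj₂ (proper q q∈F)))))
      ... | inj₂ b≼p | inj₁ q≼a = ⊥-elim (≺⇒⋡ p≺q (≼-trans q≼a (≼-trans (proj₁ a≺b) b≼p)))
      ... | inj₂ b≼p | inj₂ _ =
        suc[n∸m]≤o ρa≤ρb (ℕP.≤-trans (ℕP.≤-trans (s≤s (ρ-mono b≼p)) (ℕP.≤-trans (ρ-strict p≺q) (ρ≤d (proj₂ (proper q q∈F)))))
                                  (ℕP.m≤n+m d (ρ a)))
      ordered : (Σ V λ x → Σ V λ y → x ∈ F × y ∈ F × x ≢ y) → suc (ρ b ∸ ρ a) ≤ d
      ordered (x , y , x∈F , y∈F , x≢y) with F-chain x y x∈F y∈F
      ... | inj₁ x≼y = bound (x≼y , x≢y) x∈F y∈F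
      ... | inj₂ y≼x = bound (y≼x , x≢y ∘ sym) y∈F x∈F

    link-formula : OneSing P d →
                   ∀ F → IsFace P F → 2 ≤ ∣ F ∣ → χ̃ (inLink? P F) ≡ negOnePowℤ ((+ d - + 1) - + ∣ F ∣)
    link-formula one-sing F F-face 2≤∣F∣ =
      begin
        χ̃ (inLink? P F)                              ≡⟨ χ̃-link-chainμ F F-face ⟩
        negOnePow ∣ F ∣ * chainμ F bot top
          ≡⟨ cong (negOnePow ∣ F ∣ *_) (chainμ-Eulerian F F-face (inj₁ refl) (inj₁ refl) (bot-min top) Eulerian) ⟩
        negOnePow ∣ F ∣ * negOnePow (ρ top ∸ ρ bot)   ≡⟨ sym (link-sign ∣ F ∣) ⟩
        negOnePowℤ ((+ d - + 1) - + ∣ F ∣)           ∎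
      where
      open ≡-Reasoning
      Eulerian : EulerianSegmentsIn F F-face bot top
      Eulerian {a} {b} _ _ seg@(_ , _ , a≺b , _) =
        one-sing a b (proj₁ a≺b) (segment-length F-face 2≤∣F∣ seg) a b ≼-refl (proj₁ a≺b) ≼-refl

    LinkCondition : Set
    LinkCondition = ∀ F → IsFace P F → 2 ≤ ∣ F ∣ → χ̃ (inLink? P F) ≡ negOnePowℤ ((+ d - + 1) - + ∣ F ∣)

    link⇒chainμ : ∀ {G} → IsFace P G → χ̃ (inLink? P G) ≡ negOnePowℤ ((+ d - + 1) - + ∣ G ∣) →
                  chainμ G bot top ≡ negOnePow (ρ top ∸ ρ bot)
    link⇒chainμ {G} G-face link =
      negOnePow-*-cancelˡ ∣ G ∣ (trans (sym (χ̃-link-chainμ G G-face)) (trans link (link-sign ∣ G ∣)))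

    whole-not-short : ¬ suc (ρ top ∸ ρ bot) ≤ d
    whole-not-short short = ℕP.n≮n d
      (begin-strict
        d              <⟨ ℕP.n<1+n d ⟩
        suc d          ≡⟨ cong₂ _∸_ (sym ρ-top≡1+d) (sym ρ-bot) ⟩
        ρ top ∸ ρ bot  <⟨ short ⟩
        d              ∎)
      where open ℕP.≤-Reasoning

    cover-above-short-from-bot : ∀ {v b} → v ⋖ b → suc (ρ v ∸ ρ bot) ≤ d → b ≢ top
    cover-above-short-from-bot {v} v⋖b short refl = ℕP.n≮n d
      (begin-strict
        d            ≡⟨ ℕP.suc-injective (trans (sym ρ-top≡1+d) (⋖⇒ρ-suc v⋖b)) ⟩
        ρ v          ≡⟨ cong (ρ v ∸_) (sym ρ-bot) ⟩
        ρ v ∸ ρ bot  <⟨ short ⟩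
        d            ∎)
      where open ℕP.≤-Reasoning

    cover-below-short-to-top : ∀ {a u} → a ⋖ u → suc (ρ top ∸ ρ u) ≤ d → a ≢ bot
    cover-below-short-to-top {u = u} a⋖u short refl = ℕP.n≮n d
      (begin-strict
        d                    ≡⟨⟩
        suc d ∸ 1            ≡⟨ cong₂ _∸_ (sym ρ-top≡1+d) (cong suc (sym ρ-bot)) ⟩
        ρ top ∸ suc (ρ bot)  ≡⟨ cong (ρ top ∸_) (sym (⋖⇒ρ-suc a⋖u)) ⟩
        ρ top ∸ ρ u          <⟨ short ⟩
        d                    ∎)
      where open ℕP.≤-Reasoning

    -- If u = 0̂ (or v = 1̂), the element covering v (covered by u) is a second element of G, as [u,v] is short.
    refinement-size : ∀ {u v} (u≺v : u ≺ v) → suc (ρ v ∸ ρ u) ≤ d → ∀ {G} → Refinement u v u≺v G → 2 ≤ ∣ G ∣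
    refinement-size {u} {v} u≺v short {G} (G-face , (lower , upper , _) , covers) with u FinP.≟ bot | v FinP.≟ top
    ... | no u≢bot | no v≢top = two-elements⇒2≤∣∣ (lower-∈ lower u≢bot) (upper-∈ upper v≢top) (proj₂ u≺v)
    ... | yes refl | yes refl = ⊥-elim (whole-not-short short)
    ... | yes refl | no v≢top with segment-above (proj₂ G-face) (inj₂ (upper-∈ upper v≢top)) (≺top v≢top)
    ...   | b , seg-vb@(_ , upper-b , v≺b , _) =
      two-elements⇒2≤∣∣ (upper-∈ upper v≢top)
                         (upper-∈ upper-b (cover-above-short-from-bot (covers seg-vb (inj₂ ≼-refl)) short))
                         (proj₂ v≺b)
    refinement-size {u} {v} u≺v short {G} (G-face , (lower , upper , _) , covers) | no u≢bot | yes refl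
      with segment-below (proj₂ G-face) (inj₂ (lower-∈ lower u≢bot)) (bot≺ u≢bot)
    ... | a , seg-au@(lower-a , _ , a≺u , _) =
      two-elements⇒2≤∣∣ (lower-∈ lower-a (cover-below-short-to-top (covers seg-au (inj₁ ≼-refl)) short))
                         (lower-∈ lower u≢bot) (proj₂ a≺u)

    short-interval-Eulerian : LinkCondition → ∀ {u v} → u ≺ v → suc (ρ v ∸ ρ u) ≤ d →
                              μ P u v ≡ negOnePow (ρ v ∸ ρ u)
    short-interval-Eulerian links {u} {v} u≺v short with refinement u v u≺v
    ... | G , refined@(G-face , _) =
      negOnePow-*-cancelʳ (ρ top ∸ ρ v) (negOnePow-*-cancelˡ (ρ u ∸ ρ bot)
        (begin
          negOnePow (ρ u ∸ ρ bot) * (μ P u v * negOnePow (ρ top ∸ ρ v))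
        ≡⟨ sym (refinement-factorization u v u≺v refined) ⟩
          chainμ G bot top
        ≡⟨ link⇒chainμ G-face (links G G-face (refinement-size u≺v short refined)) ⟩
          negOnePow (ρ top ∸ ρ bot)
        ≡⟨ sym (negOnePow-∸-trans (ρ-mono (bot-min u)) (ρ-mono (top-max u))) ⟩
          negOnePow (ρ u ∸ ρ bot) * negOnePow (ρ top ∸ ρ u)
        ≡⟨ cong (negOnePow (ρ u ∸ ρ bot) *_) (sym (negOnePow-∸-trans (ρ-mono (proj₁ u≺v)) (ρ-mono (top-max v)))) ⟩
          negOnePow (ρ u ∸ ρ bot) * (negOnePow (ρ v ∸ ρ u) * negOnePow (ρ top ∸ ρ v))
        ∎))
      where open ≡-Reasoning

    links⇒one-sing : LinkCondition → OneSing P d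
    links⇒one-sing links s t s≼t short u v s≼u u≼v v≼t with u FinP.≟ v
    ... | yes refl = trans (μ≡chainμ ≼-refl) (trans (chainμ-refl ∅ u) (cong negOnePow (sym (ℕP.n∸n≡0 (ρ u)))))
    ... | no u≢v = short-interval-Eulerian links (u≼v , u≢v)
                     (ℕP.≤-trans (s≤s (ℕP.∸-mono (ρ-mono v≼t) (ρ-mono s≼u))) short)

proposition5p2 :
    (d : ℕ) (P : GradedPoset (suc d)) →
      (OneSing P d →
        (∀ (F : Subset (GradedPoset.size P)) → IsFace P F → 2 ≤ ∣ F ∣ →
          χ̃ (inLink? P F) ≡ negOnePowℤ ((+ d - + 1) - + ∣ F ∣)))
      ×
      ((∀ (F : Subset (GradedPoset.size P)) → IsFace P F → 2 ≤ ∣ F ∣ →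
          χ̃ (inLink? P F) ≡ negOnePowℤ ((+ d - + 1) - + ∣ F ∣))
        → OneSing P d)
proposition5p2 d P = link-formula P ρ-top , links⇒one-sing P ρ-top
  where open GradedPoset P using (ρ-top)
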